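{- Let $D$ be a positive squarefree integer and $K=\mathbb{Q}(\sqrt{D})$. Let $I\subseteq\mathcal{O}_K$ be a WR ideal with canonical basis $a,\ b+g\delta$, and assume that $a\mid 2D$. Then $D=d_1d_2$ for some positive integers $d_1<d_2$ with $\sqrt{D/3}\leq d_1<\sqrt{D}$, and $\Lambda_K(I)$ is similar to $\Omega_D(p,q)$ for some integers $p\geq 0$, $q>0$ with $p^2+D=q^2$, $\gcd(p,q)=1$, $p/q\leq 1/2$. In particular, the condition $a\mid 2D$ holds if either (1) $D\not\equiv 1\pmod 4$ and $\min\{a^2,\ b^2+D\}\geq 2ab$, or (2) $D\equiv 1\pmod 4$ and $\min\{a^2,\ \tfrac14((2b+1)^2+D)\}\geq 2a(b+1)$.
   Context: Let $\delta=-\sqrt{D}$ if $D\not\equiv 1\pmod 4$ and $\delta=\frac{1-\sqrt{D}}{2}$ if $D\equiv 1\pmod 4$, so $\mathcal{O}_K=\mathbb{Z}[\delta]$. The norm is $\mathbb{N}(x+y\sqrt{D})=x^2-Dy^2$. Every nonzero ideal $I\subseteq\mathcal{O}_K$ can be uniquely written as $I=\{ax+(b+g\delta)y: x,y\in\mathbb{Z}\}$ with $a,b,g\in\mathbb{Z}_{\geq 0}$, $b<a$, $g\mid a$, $g\mid b$, and $ag\mid \mathbb{N}(b+g\delta)$; the pair $a,\ b+g\delta$ is the canonical basis of $I$. The standard embedding is $\sigma_K(x+y\sqrt{D})=(x+y\sqrt{D},\,x-y\sqrt{D})\in\mathbb{R}^2$, and $\Lambda_K(I)=\sigma_K(I)$.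 A full-rank lattice in $\mathbb{R}^2$ is well-rounded (WR) if its minimal (shortest nonzero) vectors span $\mathbb{R}^2$; $I$ is WR if $\Lambda_K(I)$ is. Lattices $\Lambda_1,\Lambda_2$ are similar if $\Lambda_2=\alpha U\Lambda_1$ with $\alpha>0$ real and $U$ real orthogonal. For integers $p\geq0$, $q>0$ with $p^2+D=q^2$, $\Omega_D(p,q)=\begin{pmatrix} q&p\\0&\sqrt{D}\end{pmatrix}\mathbb{Z}^2$. -}

module Defs where

open import Data.Nat as ℕ using (ℕ; _%_; _≡ᵇ_)
open import Data.Nat.Divisibility as ℕD using ()
open import Data.Integer as ℤ using (ℤ; +_; _+_; _-_; _*_; _<_; _≤_)
open import Data.Integer.Divisibility as ℤD using ()
open import Data.Bool using (if_then_else_)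
open import Data.Product using (Σ; _×_; ∃; ∃-syntax)
open import Data.Sum using (_⊎_)
open import Relation.Binary.PropositionalEquality using (_≡_; _≢_)

SquareFree : ℕ → Set
SquareFree D = ∀ (k : ℕ) → (k ℕ.* k) ℕD.∣ D → k ≡ 1

-- Norm of b + gδ (an integer), where δ = -√D if D ≢ 1 (mod 4)
-- and δ = (1 - √D)/2 if D ≡ 1 (mod 4).
--   D ≢ 1 : N(b - g√D) = b² - D g²
--   D ≡ 1 : N(b + g/2 - (g/2)√D) = b² + b g + g² (1 - D)/4 = ((2b+g)² - D g²)/4
normBδ : ℕ → ℕ → ℕ → ℤ
normBδ D b g =
  if D % 4 ≡ᵇ 1
  then + b * + b + + b * + g + + g * + g * + ((D ℕ.∸ 1) ℕ./ 4) * ℤ.- (+ 1)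
  else + b * + b - + D * (+ g * + g)

Canonical : ℕ → ℕ → ℕ → ℕ → Set
Canonical D a b g =
  (b ℕ.< a) × (g ℕD.∣ a) × (g ℕD.∣ b) × ((+ (a ℕ.* g)) ℤD.∣ normBδ D b g)

-- A binary integral quadratic form  Q(x,y) = e x² + 2 f x y + h y²,
-- i.e. the Gram matrix [[e , f] , [f , h]] of a planar lattice w.r.t. a basis.
record Form : Set where
  constructor form
  field
    e f h : ℤ
open Form public

Q : Form → ℤ → ℤ → ℤ
Q F x y = e F * x * x + + 2 * f F * x * y + h F * y * y

B : Form → ℤ → ℤ → ℤ → ℤ → ℤ
B F x₁ y₁ x₂ y₂ = e F * x₁ * x₂ + f F * (x₁ * y₂ + y₁ * x₂) + h F * y₁ * y₂

NonZero2 : ℤ → ℤ → Set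
NonZero2 x y = (x ≢ + 0) ⊎ (y ≢ + 0)

Minimal : Form → ℤ → ℤ → Set
Minimal F x y = NonZero2 x y × (∀ u v → NonZero2 u v → Q F x y ≤ Q F u v)

WR : Form → Set
WR F = Σ ℤ λ x₁ → Σ ℤ λ y₁ → Σ ℤ λ x₂ → Σ ℤ λ y₂ →
       Minimal F x₁ y₁ × Minimal F x₂ y₂ × (x₁ * y₂ - x₂ * y₁ ≢ + 0)

-- Gram matrix of the transformed basis (columns of M = [[m₁₁,m₁₂],[m₂₁,m₂₂]]):  Mᵀ G M
transform : Form → ℤ → ℤ → ℤ → ℤ → Form
transform F m₁₁ m₁₂ m₂₁ m₂₂ =
  form (Q F m₁₁ m₂₁) (B F m₁₁ m₂₁ m₁₂ m₂₂) (Q F m₁₂ m₂₂)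

scale : ℤ → Form → Form
scale r F = form (r * e F) (r * f F) (r * h F)

-- Lattices with Gram matrices G₁, G₂ (w.r.t. some bases) are similar
-- (Λ₂ = α U Λ₁, α > 0, U orthogonal) iff  r·G₁ = s·MᵀG₂M  for some M ∈ GL₂(ℤ)
-- and positive r, s (α² = s/r is necessarily rational for integral Gram matrices).
Similar : Form → Form → Set
Similar G₁ G₂ = Σ ℤ λ m₁₁ → Σ ℤ λ m₁₂ → Σ ℤ λ m₂₁ → Σ ℤ λ m₂₂ → Σ ℤ λ r → Σ ℤ λ s →
  ((m₁₁ * m₂₂ - m₁₂ * m₂₁ ≡ + 1) ⊎ (m₁₁ * m₂₂ - m₁₂ * m₂₁ ≡ ℤ.- (+ 1))) ×
  (+ 0 < r) × (+ 0 < s) ×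
  (scale r G₁ ≡ scale s (transform G₂ m₁₁ m₁₂ m₂₁ m₂₂))

-- Twice the Gram matrix of Λ_K(I) w.r.t. σ_K(a), σ_K(b + gδ):
--  D ≢ 1 : σ(a) = (a,a), σ(b+gδ) = (b - g√D, b + g√D);
--          Gram = [[2a², 2ab],[2ab, 2(b² + g²D)]]
--  D ≡ 1 : σ(b+gδ) = (b + g/2 - (g/2)√D, b + g/2 + (g/2)√D);
--          Gram = [[2a², a(2b+g)],[a(2b+g), ((2b+g)² + g²D)/2]]
-- (Scaling by 2 does not affect well-roundedness or similarity class.)
idealForm : ℕ → ℕ → ℕ → ℕ → Form
idealForm D a b g =
  if D % 4 ≡ᵇ 1
  then form (+ 4 * + a * + a) (+ 2 * + a * (+ 2 * + b + + g))
            ((+ 2 * + b + + g) * (+ 2 * + b + + g) + + g * + g * + D)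
  else form (+ 4 * + a * + a) (+ 4 * + a * + b) (+ 4 * (+ b * + b + + g * + g * + D))

-- Gram matrix of Ω_D(p,q) = [[q , p],[0 , √D]] ℤ² : columns (q,0), (p,√D)
omegaForm : ℕ → ℕ → ℕ → Form
omegaForm D p q = form (+ q * + q) (+ q * + p) (+ p * + p + + D)

{-# OPTIONS --safe #-}
module Submission where

open import Defs

-- A reduced Gram matrix [[e , f] , [f , h]] (2|f| ≤ e, h) of a well-rounded lattice has e = h.
-- Scaling away g, let the ideal have basis A, B + δ. Squarefreeness of D turns A ∣ 2D and
-- A ∣ N(B + δ) into A ∣ 2X with X = B resp. 2B + 1, which leaves two shapes. Either D = AE and the
-- lattice is, up to scaling, spanned by (2A, 0), (A, √(AE)); it is similar to Ω_D(p, q) with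
-- {q − p, q + p} = {A, E}, and Ω_D(p, q) is reduced to q·[[q , p − q] , [p − q , 2(q − p)]], so WR
-- forces 2p ≤ q. Or D ≡ 1 and A ≡ 2 (mod 4): then all values are ≡ 2y² (mod 8) and the
-- discriminant is 16·odd, so two independent minimal vectors would have a determinant that is
-- both odd (they stay independent mod 2) and even (Lagrange's identity).
-- Under condition (1) or (2) the Gram matrix itself is reduced, and e = h forces A = 2B, D = 3B²
-- and g = 1 (so a = A ∣ 2D), resp. 4A² ≡ 2 (mod 4).

module BinaryForms where

  open import Data.Integer
    using (ℤ; +_; -[1+_]; _+_; _-_; _*_; -_; ∣_∣; _≤_; _<_; +≤+; +<+; _≟_)
  import Data.Integer as ℤ
  import Data.Integer.Properties as ℤₚ
  open import Data.Integer.DivMod using (_%ℕ_; _/ℕ_; n%ℕd<d; a≡a%ℕn+[a/ℕn]*n)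
  open import Data.Integer.Tactic.RingSolver using (solve; solve-∀)
  open import Data.Nat as ℕ using (ℕ; suc; z≤n; s≤s)
  import Data.Nat.Properties as ℕₚ
  open import Data.List using (_∷_; [])
  open import Data.Product using (Σ; _×_; _,_)
  open import Data.Sum using (_⊎_; inj₁; inj₂)
  open import Data.Empty using (⊥; ⊥-elim)
  open import Relation.Nullary using (¬_; yes; no)
  open import Relation.Binary.PropositionalEquality

  Even Odd : ℤ → Set
  Even i = Σ ℤ λ j → i ≡ + 2 * j
  Odd  i = Σ ℤ λ j → i ≡ + 2 * j + + 1

  parity : ∀ i → Even i ⊎ Odd i
  parity i = split (i %ℕ 2) (i /ℕ 2) (n%ℕd<d i 2) (a≡a%ℕn+[a/ℕn]*n i 2)
    where
    split : ∀ r q → r ℕ.< 2 → i ≡ + r + q * + 2 → Even i ⊎ Odd i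
    split 0 q _ refl = inj₁ (q , solve (q ∷ []))
    split 1 q _ refl = inj₂ (q , solve (q ∷ []))
    split (suc (suc _)) _ (s≤s (s≤s ())) _

  even≢odd : ∀ {i} → Even i → ¬ Odd i
  even≢odd (a , refl) (b , eq) = ℕₚ.even≢odd ∣ a - b ∣ 0 (begin
    2 ℕ.* ∣ a - b ∣   ≡⟨ ℤₚ.abs-* (+ 2) (a - b) ⟨
    ∣ + 2 * (a - b) ∣ ≡⟨ cong ∣_∣ (twice-difference a b eq) ⟩
    1                 ∎)
    where
    open ≡-Reasoning
    twice-difference : ∀ a b → + 2 * a ≡ + 2 * b + + 1 → + 2 * (a - b) ≡ + 1
    twice-difference a b eq = begin
      + 2 * (a - b)           ≡⟨ solve (a ∷ b ∷ []) ⟩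
      + 2 * a - + 2 * b       ≡⟨ cong (_- + 2 * b) eq ⟩
      + 2 * b + + 1 - + 2 * b ≡⟨ solve (b ∷ []) ⟩
      + 1                     ∎

  even* : ∀ {i} j → Even i → Even (i * j)
  even* j (a , refl) = a * j , solve (a ∷ j ∷ [])

  *even : ∀ i {j} → Even j → Even (i * j)
  *even i (a , refl) = i * a , solve (i ∷ a ∷ [])

  odd*odd : ∀ {i j} → Odd i → Odd j → Odd (i * j)
  odd*odd (a , refl) (b , refl) = + 2 * a * b + a + b , solve (a ∷ b ∷ [])

  even-even : ∀ {i j} → Even i → Even j → Even (i - j)
  even-even (a , refl) (b , refl) = a - b , solve (a ∷ b ∷ [])

  odd-odd : ∀ {i j} → Odd i → Odd j → Even (i - j)
  odd-odd (a , refl) (b , refl) = a - b , solve (a ∷ b ∷ [])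

  odd-even : ∀ {i j} → Odd i → Even j → Odd (i - j)
  odd-even (a , refl) (b , refl) = a - b , solve (a ∷ b ∷ [])

  even-odd : ∀ {i j} → Even i → Odd j → Odd (i - j)
  even-odd (a , refl) (b , refl) = a - b - + 1 , solve (a ∷ b ∷ [])

  form-cong : ∀ {e₁ e₂ f₁ f₂ h₁ h₂} → e₁ ≡ e₂ → f₁ ≡ f₂ → h₁ ≡ h₂ → form e₁ f₁ h₁ ≡ form e₂ f₂ h₂
  form-cong refl refl refl = refl

  Q-10 : ∀ F → Q F (+ 1) (+ 0) ≡ e F
  Q-10 (form e f h) = lemma e f h
    where
    lemma : ∀ e f h → e * + 1 * + 1 + + 2 * f * + 1 * + 0 + h * + 0 * + 0 ≡ e
    lemma = solve-∀

  Q-01 : ∀ F → Q F (+ 0) (+ 1) ≡ h F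
  Q-01 (form e f h) = lemma e f h
    where
    lemma : ∀ e f h → e * + 0 * + 0 + + 2 * f * + 0 * + 1 + h * + 1 * + 1 ≡ h
    lemma = solve-∀

  Q-swap : ∀ e f h x y → Q (form h f e) y x ≡ Q (form e f h) x y
  Q-swap e f h x y = lemma e f h x y
    where
    lemma : ∀ e f h x y →
      h * y * y + + 2 * f * y * x + e * x * x ≡ e * x * x + + 2 * f * x * y + h * y * y
    lemma = solve-∀

  Q-scale : ∀ c F x y → Q (scale c F) x y ≡ c * Q F x y
  Q-scale c (form e f h) x y = lemma c e f h x y
    where
    lemma : ∀ c e f h x y →
      c * e * x * x + + 2 * (c * f) * x * y + c * h * y * y ≡ c * (e * x * x + + 2 * f * x * y + h * y * y)
    lemma = solve-∀

  Q-transform : ∀ F a b c d x y →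
    Q (transform F a b c d) x y ≡ Q F (a * x + b * y) (c * x + d * y)
  Q-transform (form e f h) a b c d x y = lemma e f h a b c d x y
    where
    lemma : ∀ e f h a b c d x y →
      (e * a * a + + 2 * f * a * c + h * c * c) * x * x
      + + 2 * (e * a * b + f * (a * d + c * b) + h * c * d) * x * y
      + (e * b * b + + 2 * f * b * d + h * d * d) * y * y
      ≡ e * (a * x + b * y) * (a * x + b * y) + + 2 * f * (a * x + b * y) * (c * x + d * y)
        + h * (c * x + d * y) * (c * x + d * y)
    lemma = solve-∀

  Q-double : ∀ F x y → Q F (+ 2 * x) (+ 2 * y) ≡ + 4 * Q F x y
  Q-double (form e f h) x y = lemma e f h x y
    where
    lemma : ∀ e f h x y →
      e * (+ 2 * x) * (+ 2 * x) + + 2 * f * (+ 2 * x) * (+ 2 * y) + h * (+ 2 * y) * (+ 2 * y)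
      ≡ + 4 * (e * x * x + + 2 * f * x * y + h * y * y)
    lemma = solve-∀

  Q-sum : ∀ F x₁ y₁ x₂ y₂ →
    Q F (x₁ + x₂) (y₁ + y₂) ≡ Q F x₁ y₁ + Q F x₂ y₂ + + 2 * B F x₁ y₁ x₂ y₂
  Q-sum (form e f h) x₁ y₁ x₂ y₂ = lemma e f h x₁ y₁ x₂ y₂
    where
    lemma : ∀ e f h x₁ y₁ x₂ y₂ →
      e * (x₁ + x₂) * (x₁ + x₂) + + 2 * f * (x₁ + x₂) * (y₁ + y₂) + h * (y₁ + y₂) * (y₁ + y₂)
      ≡ (e * x₁ * x₁ + + 2 * f * x₁ * y₁ + h * y₁ * y₁) + (e * x₂ * x₂ + + 2 * f * x₂ * y₂ + h * y₂ * y₂)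
        + + 2 * (e * x₁ * x₂ + f * (x₁ * y₂ + y₁ * x₂) + h * y₁ * y₂)
    lemma = solve-∀

  parallelogram : ∀ F x₁ y₁ x₂ y₂ →
    Q F (x₁ + x₂) (y₁ + y₂) + Q F (x₁ - x₂) (y₁ - y₂) ≡ + 2 * Q F x₁ y₁ + + 2 * Q F x₂ y₂
  parallelogram (form e f h) x₁ y₁ x₂ y₂ = lemma e f h x₁ y₁ x₂ y₂
    where
    lemma : ∀ e f h x₁ y₁ x₂ y₂ →
      (e * (x₁ + x₂) * (x₁ + x₂) + + 2 * f * (x₁ + x₂) * (y₁ + y₂) + h * (y₁ + y₂) * (y₁ + y₂))
      + (e * (x₁ - x₂) * (x₁ - x₂) + + 2 * f * (x₁ - x₂) * (y₁ - y₂) + h * (y₁ - y₂) * (y₁ - y₂))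
      ≡ + 2 * (e * x₁ * x₁ + + 2 * f * x₁ * y₁ + h * y₁ * y₁) + + 2 * (e * x₂ * x₂ + + 2 * f * x₂ * y₂ + h * y₂ * y₂)
    lemma = solve-∀

  lagrange : ∀ F x₁ y₁ x₂ y₂ →
    Q F x₁ y₁ * Q F x₂ y₂ - B F x₁ y₁ x₂ y₂ * B F x₁ y₁ x₂ y₂
    ≡ (e F * h F - f F * f F) * ((x₁ * y₂ - x₂ * y₁) * (x₁ * y₂ - x₂ * y₁))
  lagrange (form e f h) x₁ y₁ x₂ y₂ = lemma e f h x₁ y₁ x₂ y₂
    where
    lemma : ∀ e f h x₁ y₁ x₂ y₂ →
      (e * x₁ * x₁ + + 2 * f * x₁ * y₁ + h * y₁ * y₁) * (e * x₂ * x₂ + + 2 * f * x₂ * y₂ + h * y₂ * y₂)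
      - (e * x₁ * x₂ + f * (x₁ * y₂ + y₁ * x₂) + h * y₁ * y₂) * (e * x₁ * x₂ + f * (x₁ * y₂ + y₁ * x₂) + h * y₁ * y₂)
      ≡ (e * h - f * f) * ((x₁ * y₂ - x₂ * y₁) * (x₁ * y₂ - x₂ * y₁))
    lemma = solve-∀

  nonZero2-of-det : ∀ {k} s t a b → k ≡ s * a - b * t → k ≢ + 0 → NonZero2 s t
  nonZero2-of-det s t a b k≡ k≢0 with s ≟ + 0 | t ≟ + 0
  ... | no s≢0  | _        = inj₁ s≢0
  ... | yes _   | no t≢0   = inj₂ t≢0
  ... | yes refl | yes refl = ⊥-elim (k≢0 (trans k≡ (lemma a b)))
    where
    lemma : ∀ a b → + 0 * a - b * + 0 ≡ + 0
    lemma = solve-∀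

  nonZero2-of-image : ∀ {u w} x y α β γ δ →
    u ≡ α * x + β * y → w ≡ γ * x + δ * y → NonZero2 u w → NonZero2 x y
  nonZero2-of-image x y α β γ δ u≡ w≡ u,w≢0 with x ≟ + 0 | y ≟ + 0
  ... | no x≢0   | _        = inj₁ x≢0
  ... | yes _    | no y≢0   = inj₂ y≢0
  ... | yes refl | yes refl with u,w≢0
  ...   | inj₁ u≢0 = ⊥-elim (u≢0 (trans u≡ (lemma α β)))
    where
    lemma : ∀ α β → α * + 0 + β * + 0 ≡ + 0
    lemma = solve-∀
  ...   | inj₂ w≢0 = ⊥-elim (w≢0 (trans w≡ (lemma γ δ)))
    where
    lemma : ∀ γ δ → γ * + 0 + δ * + 0 ≡ + 0
    lemma = solve-∀

  minimal≤e : ∀ {F x y} → Minimal F x y → Q F x y ≤ e F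
  minimal≤e {F} (_ , min) = subst (Q F _ _ ≤_) (Q-10 F) (min (+ 1) (+ 0) (inj₁ λ ()))

  minimal≤h : ∀ {F x y} → Minimal F x y → Q F x y ≤ h F
  minimal≤h {F} (_ , min) = subst (Q F _ _ ≤_) (Q-01 F) (min (+ 0) (+ 1) (inj₂ λ ()))

  square-abs : ∀ i → i * i ≡ + (∣ i ∣ ℕ.* ∣ i ∣)
  square-abs (+ n)    = sym (ℤₚ.pos-* n n)
  square-abs -[1+ n ] = refl

  0≤∣i∣+i : ∀ i → + 0 ≤ + ∣ i ∣ + i
  0≤∣i∣+i (+ n)    = +≤+ z≤n
  0≤∣i∣+i -[1+ n ] = ℤₚ.≤-reflexive (sym (ℤₚ.n⊖n≡0 (suc n)))

  ≤-+-nonNeg : ∀ i {j} → + 0 ≤ j → i ≤ i + j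
  ≤-+-nonNeg i {j} 0≤j = subst (λ k → i ≤ i + k) (ℤₚ.0≤i⇒+∣i∣≡i 0≤j) (ℤₚ.i≤i+j i (+ ∣ j ∣))

  reduced-boundℕ : ∀ {e h F} X Y → 2 ℕ.* F ℕ.≤ e → 2 ℕ.* F ℕ.≤ h → 1 ℕ.≤ Y →
    2 ℕ.* F ℕ.* (X ℕ.* Y) ℕ.+ h ℕ.≤ e ℕ.* (X ℕ.* X) ℕ.+ h ℕ.* (Y ℕ.* Y)
  reduced-boundℕ {e} {h} {F} X Y 2F≤e 2F≤h 1≤Y with ℕₚ.≤-<-connex Y X
  ... | inj₁ Y≤X = ℕₚ.+-mono-≤ (ℕₚ.*-mono-≤ 2F≤e (ℕₚ.*-monoʳ-≤ X Y≤X))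
                               (subst (ℕ._≤ h ℕ.* (Y ℕ.* Y)) (ℕₚ.*-identityʳ h)
                                  (ℕₚ.*-monoʳ-≤ h (ℕₚ.*-mono-≤ 1≤Y 1≤Y)))
  ... | inj₂ X<Y = begin
    2 ℕ.* F ℕ.* (X ℕ.* Y) ℕ.+ h ≤⟨ ℕₚ.+-monoˡ-≤ h (ℕₚ.*-monoˡ-≤ (X ℕ.* Y) 2F≤h) ⟩
    h ℕ.* (X ℕ.* Y) ℕ.+ h       ≡⟨ trans (ℕₚ.*-distribˡ-+ h (X ℕ.* Y) 1) (cong (h ℕ.* (X ℕ.* Y) ℕ.+_) (ℕₚ.*-identityʳ h)) ⟨
    h ℕ.* (X ℕ.* Y ℕ.+ 1)       ≤⟨ ℕₚ.*-monoʳ-≤ h XY+1≤YY ⟩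
    h ℕ.* (Y ℕ.* Y)             ≤⟨ ℕₚ.m≤n+m _ _ ⟩
    e ℕ.* (X ℕ.* X) ℕ.+ h ℕ.* (Y ℕ.* Y) ∎
    where
    open ℕₚ.≤-Reasoning
    XY+1≤YY : X ℕ.* Y ℕ.+ 1 ℕ.≤ Y ℕ.* Y
    XY+1≤YY = begin
      X ℕ.* Y ℕ.+ 1 ≤⟨ ℕₚ.+-monoʳ-≤ (X ℕ.* Y) 1≤Y ⟩
      X ℕ.* Y ℕ.+ Y ≡⟨ ℕₚ.+-comm (X ℕ.* Y) Y ⟩
      suc X ℕ.* Y   ≤⟨ ℕₚ.*-monoˡ-≤ Y X<Y ⟩
      Y ℕ.* Y       ∎

  1≤∣i∣ : ∀ {i} → i ≢ + 0 → 1 ℕ.≤ ∣ i ∣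
  1≤∣i∣ i≢0 = ℕₚ.n≢0⇒n>0 (λ ∣i∣≡0 → i≢0 (ℤₚ.∣i∣≡0⇒i≡0 ∣i∣≡0))

  reduced-lower-bound : ∀ {e h} f x y → 2 ℕ.* ∣ f ∣ ℕ.≤ e → 2 ℕ.* ∣ f ∣ ℕ.≤ h → y ≢ + 0 →
    + h ≤ Q (form (+ e) f (+ h)) x y
  reduced-lower-bound {e} {h} f x y 2F≤e 2F≤h y≢0
    with ℕₚ.m≤n⇒∃[o]m+o≡n (reduced-boundℕ {F = ∣ f ∣} ∣ x ∣ ∣ y ∣ 2F≤e 2F≤h (1≤∣i∣ y≢0))
  ... | w , bound≡ = subst (+ h ≤_) (sym Q≡) (≤-+-nonNeg (+ h) slack≥0)
    where
    open ≡-Reasoning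
    t : ℤ
    t = f * x * y
    F : ℕ
    F = ∣ f ∣
    X : ℕ
    X = ∣ x ∣
    Y : ℕ
    Y = ∣ y ∣
    ∣t∣≡ : + ∣ t ∣ ≡ + F * + (X ℕ.* Y)
    ∣t∣≡ = trans (cong +_ (trans (ℤₚ.abs-* (f * x) y)
                            (trans (cong (ℕ._* Y) (ℤₚ.abs-* f x)) (ℕₚ.*-assoc F X Y))))
                 (ℤₚ.pos-* F (X ℕ.* Y))
    regroup : ∀ E H f x y → E * x * x + + 2 * f * x * y + H * y * y ≡ E * (x * x) + H * (y * y) + + 2 * (f * x * y)
    regroup = solve-∀
    regroup-slack : ∀ a b h w t → + 2 * a * b + h + w + + 2 * t ≡ h + (w + + 2 * (a * b + t))
    regroup-slack = solve-∀
    Q≡ : Q (form (+ e) f (+ h)) x y ≡ + h + (+ w + + 2 * (+ ∣ t ∣ + t))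
    Q≡ = begin
      + e * x * x + + 2 * f * x * y + + h * y * y
        ≡⟨ regroup (+ e) (+ h) f x y ⟩
      + e * (x * x) + + h * (y * y) + + 2 * t
        ≡⟨ cong₂ (λ u v → + e * u + + h * v + + 2 * t) (square-abs x) (square-abs y) ⟩
      + e * + (X ℕ.* X) + + h * + (Y ℕ.* Y) + + 2 * t
        ≡⟨ cong (_+ + 2 * t) (cong₂ _+_ (ℤₚ.pos-* e _) (ℤₚ.pos-* h _)) ⟨
      + (e ℕ.* (X ℕ.* X)) + + (h ℕ.* (Y ℕ.* Y)) + + 2 * t
        ≡⟨ cong (_+ + 2 * t) (ℤₚ.pos-+ (e ℕ.* (X ℕ.* X)) (h ℕ.* (Y ℕ.* Y))) ⟨
      + (e ℕ.* (X ℕ.* X) ℕ.+ h ℕ.* (Y ℕ.* Y)) + + 2 * t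
        ≡⟨ cong (λ n → + n + + 2 * t) bound≡ ⟨
      + (2 ℕ.* F ℕ.* (X ℕ.* Y) ℕ.+ h ℕ.+ w) + + 2 * t
        ≡⟨ cong (_+ + 2 * t) (trans (ℤₚ.pos-+ _ w) (cong (_+ + w) (ℤₚ.pos-+ _ h))) ⟩
      + (2 ℕ.* F ℕ.* (X ℕ.* Y)) + + h + + w + + 2 * t
        ≡⟨ cong (λ u → u + + h + + w + + 2 * t)
                (trans (ℤₚ.pos-* (2 ℕ.* F) (X ℕ.* Y)) (cong (_* + (X ℕ.* Y)) (ℤₚ.pos-* 2 F))) ⟩
      + 2 * + F * + (X ℕ.* Y) + + h + + w + + 2 * t
        ≡⟨ regroup-slack (+ F) (+ (X ℕ.* Y)) (+ h) (+ w) t ⟩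
      + h + (+ w + + 2 * (+ F * + (X ℕ.* Y) + t))
        ≡⟨ cong (λ u → + h + (+ w + + 2 * (u + t))) ∣t∣≡ ⟨
      + h + (+ w + + 2 * (+ ∣ t ∣ + t)) ∎
    slack≥0 : + 0 ≤ + w + + 2 * (+ ∣ t ∣ + t)
    slack≥0 = ℤₚ.+-mono-≤ (+≤+ z≤n) (ℤₚ.*-monoˡ-≤-nonNeg (+ 2) (0≤∣i∣+i t))

  reduced-WR⇒e≡h : ∀ {e h} f → 2 ℕ.* ∣ f ∣ ℕ.≤ e → 2 ℕ.* ∣ f ∣ ℕ.≤ h → WR (form (+ e) f (+ h)) → e ≡ h
  reduced-WR⇒e≡h {e} {h} f 2F≤e 2F≤h (x₁ , y₁ , x₂ , y₂ , min₁ , min₂ , k≢0) =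
    ℤₚ.+-injective (ℤₚ.≤-antisym e≤h h≤e)
    where
    F : Form
    F = form (+ e) f (+ h)
    h≤Q : ∀ {x y} → y ≢ + 0 → + h ≤ Q F x y
    h≤Q {x} {y} = reduced-lower-bound f x y 2F≤e 2F≤h
    e≤Q : ∀ {x y} → x ≢ + 0 → + e ≤ Q F x y
    e≤Q {x} {y} x≢0 = subst (+ e ≤_) (Q-swap (+ e) f (+ h) x y) (reduced-lower-bound f y x 2F≤h 2F≤e x≢0)
    h≤e : + h ≤ + e
    h≤e with nonZero2-of-det {x₁ * y₂ - x₂ * y₁} y₂ y₁ x₁ x₂ (solve (x₁ ∷ y₁ ∷ x₂ ∷ y₂ ∷ [])) k≢0
    ... | inj₁ y₂≢0 = ℤₚ.≤-trans (h≤Q y₂≢0) (minimal≤e {F} min₂)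
    ... | inj₂ y₁≢0 = ℤₚ.≤-trans (h≤Q y₁≢0) (minimal≤e {F} min₁)
    e≤h : + e ≤ + h
    e≤h with nonZero2-of-det {x₁ * y₂ - x₂ * y₁} x₁ x₂ y₂ y₁ (solve (x₁ ∷ y₁ ∷ x₂ ∷ y₂ ∷ [])) k≢0
    ... | inj₁ x₁≢0 = ℤₚ.≤-trans (e≤Q x₁≢0) (minimal≤h {F} min₁)
    ... | inj₂ x₂≢0 = ℤₚ.≤-trans (e≤Q x₂≢0) (minimal≤h {F} min₂)

  WR-scale : ∀ {c} F → + 0 < c → WR F → WR (scale c F)
  WR-scale {c} F 0<c (x₁ , y₁ , x₂ , y₂ , min₁ , min₂ , k≢0) =
    x₁ , y₁ , x₂ , y₂ , scaled min₁ , scaled min₂ , k≢0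
    where
    scaled : ∀ {x y} → Minimal F x y → Minimal (scale c F) x y
    scaled {x} {y} (nz , min) = nz , λ u v nz′ →
      subst₂ _≤_ (sym (Q-scale c F x y)) (sym (Q-scale c F u v))
        (ℤₚ.*-monoˡ-≤-nonNeg c {{ℤ.nonNegative (ℤₚ.<⇒≤ 0<c)}} (min u v nz′))

  WR-scale⁻¹ : ∀ {c} F → + 0 < c → WR (scale c F) → WR F
  WR-scale⁻¹ {c} F 0<c (x₁ , y₁ , x₂ , y₂ , min₁ , min₂ , k≢0) =
    x₁ , y₁ , x₂ , y₂ , unscaled min₁ , unscaled min₂ , k≢0
    where
    unscaled : ∀ {x y} → Minimal (scale c F) x y → Minimal F x y
    unscaled {x} {y} (nz , min) = nz , λ u v nz′ →
      ℤₚ.*-cancelˡ-≤-pos (Q F x y) (Q F u v) c {{ℤ.positive 0<c}}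
        (subst₂ _≤_ (Q-scale c F x y) (Q-scale c F u v) (min u v nz′))

  Unimodular : ℤ → ℤ → ℤ → ℤ → Set
  Unimodular a b c d = (a * d - b * c ≡ + 1) ⊎ (a * d - b * c ≡ - + 1)

  unimodular² : ∀ {a b c d} → Unimodular a b c d → (a * d - b * c) * (a * d - b * c) ≡ + 1
  unimodular² (inj₁ Δ≡1)  rewrite Δ≡1  = refl
  unimodular² (inj₂ Δ≡-1) rewrite Δ≡-1 = refl

  WR-transform⁻¹ : ∀ F a b c d → Unimodular a b c d → WR (transform F a b c d) → WR F
  WR-transform⁻¹ F a b c d unimodular (x₁ , y₁ , x₂ , y₂ , min₁ , min₂ , k≢0) =
    a * x₁ + b * y₁ , c * x₁ + d * y₁ , a * x₂ + b * y₂ , c * x₂ + d * y₂ ,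
    image-minimal min₁ , image-minimal min₂ , image-independent
    where
    open ℤₚ.≤-Reasoning
    T : Form
    T = transform F a b c d
    Δ : ℤ
    Δ = a * d - b * c
    ΔΔ*i≡i : ∀ i → Δ * Δ * i ≡ i
    ΔΔ*i≡i i = trans (cong (_* i) (unimodular² {a} {b} {c} {d} unimodular)) (ℤₚ.*-identityˡ i)
    -- (pre₁ , pre₂) = Δ · adj M is the inverse of M = [[a , b] , [c , d]], since Δ² = 1
    pre₁ pre₂ : ℤ → ℤ → ℤ
    pre₁ u w = Δ * d * u + - (Δ * b) * w
    pre₂ u w = - (Δ * c) * u + Δ * a * w
    M∘pre₁ : ∀ u w → a * pre₁ u w + b * pre₂ u w ≡ u
    M∘pre₁ u w = trans (lemma a b c d u w) (ΔΔ*i≡i u)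
      where
      lemma : ∀ a b c d u w →
        a * ((a * d - b * c) * d * u + - ((a * d - b * c) * b) * w)
        + b * (- ((a * d - b * c) * c) * u + (a * d - b * c) * a * w)
        ≡ (a * d - b * c) * (a * d - b * c) * u
      lemma = solve-∀
    M∘pre₂ : ∀ u w → c * pre₁ u w + d * pre₂ u w ≡ w
    M∘pre₂ u w = trans (lemma a b c d u w) (ΔΔ*i≡i w)
      where
      lemma : ∀ a b c d u w →
        c * ((a * d - b * c) * d * u + - ((a * d - b * c) * b) * w)
        + d * (- ((a * d - b * c) * c) * u + (a * d - b * c) * a * w)
        ≡ (a * d - b * c) * (a * d - b * c) * w
      lemma = solve-∀
    pre₁∘M : ∀ x y → pre₁ (a * x + b * y) (c * x + d * y) ≡ x
    pre₁∘M x y = trans (lemma a b c d x y) (ΔΔ*i≡i x)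
      where
      lemma : ∀ a b c d x y →
        (a * d - b * c) * d * (a * x + b * y) + - ((a * d - b * c) * b) * (c * x + d * y)
        ≡ (a * d - b * c) * (a * d - b * c) * x
      lemma = solve-∀
    pre₂∘M : ∀ x y → pre₂ (a * x + b * y) (c * x + d * y) ≡ y
    pre₂∘M x y = trans (lemma a b c d x y) (ΔΔ*i≡i y)
      where
      lemma : ∀ a b c d x y →
        - ((a * d - b * c) * c) * (a * x + b * y) + (a * d - b * c) * a * (c * x + d * y)
        ≡ (a * d - b * c) * (a * d - b * c) * y
      lemma = solve-∀
    image-minimal : ∀ {x y} → Minimal T x y → Minimal F (a * x + b * y) (c * x + d * y)
    image-minimal {x} {y} (nz , min) =
      nonZero2-of-image _ _ (Δ * d) (- (Δ * b)) (- (Δ * c)) (Δ * a) (sym (pre₁∘M x y)) (sym (pre₂∘M x y)) nz ,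
      λ u w nz′ → begin
        Q F (a * x + b * y) (c * x + d * y)     ≡⟨ Q-transform F a b c d x y ⟨
        Q T x y                                 ≤⟨ min (pre₁ u w) (pre₂ u w)
                                                     (nonZero2-of-image _ _ a b c d (sym (M∘pre₁ u w)) (sym (M∘pre₂ u w)) nz′) ⟩
        Q T (pre₁ u w) (pre₂ u w)               ≡⟨ Q-transform F a b c d (pre₁ u w) (pre₂ u w) ⟩
        Q F (a * pre₁ u w + b * pre₂ u w) (c * pre₁ u w + d * pre₂ u w)
                                                ≡⟨ cong₂ (Q F) (M∘pre₁ u w) (M∘pre₂ u w) ⟩
        Q F u w                                 ∎
    image-independent : (a * x₁ + b * y₁) * (c * x₂ + d * y₂) - (a * x₂ + b * y₂) * (c * x₁ + d * y₁) ≢ + 0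
    image-independent det≡0 = k≢0 (begin-equality
      x₁ * y₂ - x₂ * y₁               ≡⟨ ΔΔ*i≡i _ ⟨
      Δ * Δ * (x₁ * y₂ - x₂ * y₁)     ≡⟨ ℤₚ.*-assoc Δ Δ _ ⟩
      Δ * (Δ * (x₁ * y₂ - x₂ * y₁))   ≡⟨ cong (Δ *_) (trans (sym (det-image a b c d x₁ y₁ x₂ y₂)) det≡0) ⟩
      Δ * + 0                         ≡⟨ ℤₚ.*-zeroʳ Δ ⟩
      + 0                             ∎)
      where
      det-image : ∀ a b c d x₁ y₁ x₂ y₂ →
        (a * x₁ + b * y₁) * (c * x₂ + d * y₂) - (a * x₂ + b * y₂) * (c * x₁ + d * y₁)
        ≡ (a * d - b * c) * (x₁ * y₂ - x₂ * y₁)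
      det-image = solve-∀

  WR-similar : ∀ {F} G → Similar F G → WR F → WR G
  WR-similar {F} G (a , b , c , d , r , s , unimodular , 0<r , 0<s , rF≡sMᵀGM) wr =
    WR-transform⁻¹ G a b c d unimodular
      (WR-scale⁻¹ (transform G a b c d) 0<s (subst WR rF≡sMᵀGM (WR-scale F 0<r wr)))

  pos*pos : ∀ {i j} → + 0 < i → + 0 < j → + 0 < i * j
  pos*pos (+<+ {n = suc _} _) (+<+ {n = suc _} _) = +<+ (s≤s z≤n)

  Similar-scaleˡ : ∀ {σ F G} → + 0 < σ → Similar F G → Similar (scale σ F) G
  Similar-scaleˡ {σ} 0<σ (a , b , c , d , r , s , unimodular , 0<r , 0<s , rF≡sMᵀGM) =
    a , b , c , d , r , s * σ , unimodular , 0<r , pos*pos 0<s 0<σ ,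
    form-cong (rescale (cong e rF≡sMᵀGM)) (rescale (cong f rF≡sMᵀGM)) (rescale (cong h rF≡sMᵀGM))
    where
    open ≡-Reasoning
    rescale : ∀ {x y} → r * x ≡ s * y → r * (σ * x) ≡ s * σ * y
    rescale {x} {y} rx≡sy = begin
      r * (σ * x) ≡⟨ solve (r ∷ σ ∷ x ∷ []) ⟩
      σ * (r * x) ≡⟨ cong (σ *_) rx≡sy ⟩
      σ * (s * y) ≡⟨ solve (σ ∷ s ∷ y ∷ []) ⟩
      s * σ * y   ∎

  PositiveDefinite : Form → Set
  PositiveDefinite F = ∀ x y → NonZero2 x y → + 0 < Q F x y

  0≤i*i : ∀ i → + 0 ≤ i * i
  0≤i*i i = subst (+ 0 ≤_) (sym (square-abs i)) (+≤+ z≤n)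

  0<i*i : ∀ {i} → i ≢ + 0 → + 0 < i * i
  0<i*i {i} i≢0 = subst (+ 0 <_) (sym (square-abs i)) (+<+ (ℕₚ.*-mono-≤ (1≤∣i∣ i≢0) (1≤∣i∣ i≢0)))

  positive-definite : ∀ F → + 0 < e F → + 0 < e F * h F - f F * f F → PositiveDefinite F
  positive-definite F@(form e f h) 0<e 0<Δ x y x,y≢0 =
    ℤₚ.*-cancelˡ-<-nonNeg e {{ℤ.nonNegative (ℤₚ.<⇒≤ 0<e)}}
      (subst₂ _<_ (sym (ℤₚ.*-zeroʳ e)) (sym (completed-square e f h x y)) (0<sum y x,y≢0))
    where
    Δ : ℤ
    Δ = e * h - f * f
    completed-square : ∀ e f h x y →
      e * (e * x * x + + 2 * f * x * y + h * y * y) ≡ (e * x + f * y) * (e * x + f * y) + (e * h - f * f) * (y * y)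
    completed-square = solve-∀
    0≤Δy² : ∀ y → + 0 ≤ Δ * (y * y)
    0≤Δy² y = subst (_≤ Δ * (y * y)) (ℤₚ.*-zeroʳ Δ)
              (ℤₚ.*-monoˡ-≤-nonNeg Δ {{ℤ.nonNegative (ℤₚ.<⇒≤ 0<Δ)}} (0≤i*i y))
    0<sum : ∀ y → NonZero2 x y → + 0 < (e * x + f * y) * (e * x + f * y) + Δ * (y * y)
    0<sum y x,y≢0 with y ≟ + 0 | x,y≢0
    ... | no y≢0    | _        = ℤₚ.+-mono-≤-< (0≤i*i (e * x + f * y)) (pos*pos 0<Δ (0<i*i y≢0))
    ... | yes refl  | inj₂ y≢0 = ⊥-elim (y≢0 refl)
    ... | yes refl  | inj₁ x≢0 = ℤₚ.+-mono-<-≤ (0<i*i ex+f0≢0) (0≤Δy² (+ 0))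
      where
      drop-zero : ∀ e f x → e * x ≡ e * x + f * + 0
      drop-zero = solve-∀
      ex+f0≢0 : e * x + f * + 0 ≢ + 0
      ex+f0≢0 ex+f0≡0 with ℤₚ.i*j≡0⇒i≡0∨j≡0 e (trans (drop-zero e f x) ex+f0≡0)
      ... | inj₁ refl = ℤₚ.<-irrefl refl 0<e
      ... | inj₂ x≡0  = x≢0 x≡0

  even-det-cases : ∀ x₁ y₁ x₂ y₂ → Even (x₁ * y₂ - x₂ * y₁) →
    (Even x₁ × Even y₁) ⊎ (Even x₂ × Even y₂) ⊎ (Even (x₁ - x₂) × Even (y₁ - y₂))
  even-det-cases x₁ y₁ x₂ y₂ even-det with parity x₁ | parity y₁ | parity x₂ | parity y₂
  ... | inj₁ a | inj₁ b | _      | _      = inj₁ (a , b)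
  ... | _      | _      | inj₁ c | inj₁ d = inj₂ (inj₁ (c , d))
  ... | inj₂ a | inj₁ b | inj₂ c | inj₁ d = inj₂ (inj₂ (odd-odd a c , even-even b d))
  ... | inj₁ a | inj₂ b | inj₁ c | inj₂ d = inj₂ (inj₂ (even-even a c , odd-odd b d))
  ... | inj₂ a | inj₂ b | inj₂ c | inj₂ d = inj₂ (inj₂ (odd-odd a c , odd-odd b d))
  ... | inj₂ a | inj₁ b | inj₁ c | inj₂ d = ⊥-elim (even≢odd even-det (odd-even (odd*odd a d) (even* y₁ c)))
  ... | inj₂ a | inj₁ b | inj₂ c | inj₂ d = ⊥-elim (even≢odd even-det (odd-even (odd*odd a d) (*even x₂ b)))
  ... | inj₁ a | inj₂ b | inj₂ c | inj₁ d = ⊥-elim (even≢odd even-det (even-odd (even* y₂ a) (odd*odd c b)))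
  ... | inj₁ a | inj₂ b | inj₂ c | inj₂ d = ⊥-elim (even≢odd even-det (even-odd (even* y₂ a) (odd*odd c b)))
  ... | inj₂ a | inj₂ b | inj₂ c | inj₁ d = ⊥-elim (even≢odd even-det (even-odd (*even x₁ d) (odd*odd c b)))
  ... | inj₂ a | inj₂ b | inj₁ c | inj₂ d = ⊥-elim (even≢odd even-det (odd-even (odd*odd a d) (even* y₁ c)))

  minimal-equal : ∀ {F x₁ y₁ x₂ y₂} → Minimal F x₁ y₁ → Minimal F x₂ y₂ → Q F x₁ y₁ ≡ Q F x₂ y₂
  minimal-equal (nz₁ , min₁) (nz₂ , min₂) = ℤₚ.≤-antisym (min₁ _ _ nz₂) (min₂ _ _ nz₁)

  minimal-not-double : ∀ {F} u w → PositiveDefinite F → NonZero2 u w → ¬ Minimal F (+ 2 * u) (+ 2 * w)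
  minimal-not-double {F} u w pd u,w≢0 (_ , min) = 4≰1 (ℤₚ.*-cancelʳ-≤-pos (+ 4) (+ 1) (Q F u w) {{ℤ.positive (pd u w u,w≢0)}}
    (begin
      + 4 * Q F u w       ≡⟨ Q-double F u w ⟨
      Q F (+ 2 * u) (+ 2 * w) ≤⟨ min u w u,w≢0 ⟩
      Q F u w             ≡⟨ ℤₚ.*-identityˡ _ ⟨
      + 1 * Q F u w       ∎))
    where
    open ℤₚ.≤-Reasoning
    4≰1 : ¬ (+ 4 ≤ + 1)
    4≰1 (+≤+ (s≤s ()))

  minimal-not-congruent : ∀ {F x₁ y₁ x₂ y₂} u w → PositiveDefinite F → Minimal F x₁ y₁ → Minimal F x₂ y₂ →
    NonZero2 u w → x₁ - x₂ ≡ + 2 * u → y₁ - y₂ ≡ + 2 * w → NonZero2 (x₁ + x₂) (y₁ + y₂) → ⊥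
  minimal-not-congruent {F} {x₁} {y₁} {x₂} {y₂} u w pd min₁@(nz₁ , below₁) min₂ u,w≢0 x₁-x₂≡ y₁-y₂≡ sum≢0 =
    5≰4 (ℤₚ.*-cancelʳ-≤-pos (+ 5) (+ 4) m {{ℤ.positive (pd x₁ y₁ nz₁)}} (begin
      + 5 * m                                         ≡⟨ split-5 m ⟩
      m + + 4 * m                                     ≤⟨ ℤₚ.+-mono-≤ (below₁ _ _ sum≢0)
                                                            (ℤₚ.*-monoˡ-≤-nonNeg (+ 4) (below₁ u w u,w≢0)) ⟩
      Q F (x₁ + x₂) (y₁ + y₂) + + 4 * Q F u w        ≡⟨ cong (λ q → Q F (x₁ + x₂) (y₁ + y₂) + q)
                                                            (trans (sym (Q-double F u w)) (sym (cong₂ (Q F) x₁-x₂≡ y₁-y₂≡))) ⟩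
      Q F (x₁ + x₂) (y₁ + y₂) + Q F (x₁ - x₂) (y₁ - y₂) ≡⟨ parallelogram F x₁ y₁ x₂ y₂ ⟩
      + 2 * m + + 2 * Q F x₂ y₂                       ≡⟨ cong (λ q → + 2 * m + + 2 * q) (minimal-equal {F} min₁ min₂) ⟨
      + 2 * m + + 2 * m                               ≡⟨ join-4 m ⟩
      + 4 * m                                         ∎))
    where
    open ℤₚ.≤-Reasoning
    m : ℤ
    m = Q F x₁ y₁
    split-5 : ∀ m → + 5 * m ≡ m + + 4 * m
    split-5 = solve-∀
    join-4 : ∀ m → + 2 * m + + 2 * m ≡ + 4 * m
    join-4 = solve-∀
    5≰4 : ¬ (+ 5 ≤ + 4)
    5≰4 (+≤+ (s≤s (s≤s (s≤s (s≤s ())))))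

  -- A minimal vector is never twice a lattice vector, and two minimal vectors are never
  -- congruent mod 2; so mod 2 two independent minimal vectors stay independent.
  minimal-det-not-even : ∀ {F x₁ y₁ x₂ y₂} → PositiveDefinite F → Minimal F x₁ y₁ → Minimal F x₂ y₂ →
    x₁ * y₂ - x₂ * y₁ ≢ + 0 → ¬ Even (x₁ * y₂ - x₂ * y₁)
  minimal-det-not-even {F} {x₁} {y₁} {x₂} {y₂} pd min₁ min₂ k≢0 even-det
    with even-det-cases x₁ y₁ x₂ y₂ even-det
  ... | inj₁ ((u , refl) , (w , refl)) =
    minimal-not-double {F} u w pd
      (nonZero2-of-det {+ 2 * u * y₂ - x₂ * (+ 2 * w)} u w (+ 2 * y₂) (x₂ * + 2) (solve (u ∷ w ∷ x₂ ∷ y₂ ∷ [])) k≢0) min₁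
  ... | inj₂ (inj₁ ((u , refl) , (w , refl))) =
    minimal-not-double {F} u w pd
      (nonZero2-of-det {x₁ * (+ 2 * w) - + 2 * u * y₁} u w (- (+ 2 * y₁)) (- (x₁ * + 2)) (solve (x₁ ∷ y₁ ∷ u ∷ w ∷ [])) k≢0)
      min₂
  ... | inj₂ (inj₂ ((u , x₁-x₂≡) , (w , y₁-y₂≡))) =
    minimal-not-congruent {F} u w pd min₁ min₂
      (nonZero2-of-det u w (+ 2 * y₂) (x₂ * + 2) k≡ k≢0) x₁-x₂≡ y₁-y₂≡
      (nonZero2-of-det {x₁ * y₂ - x₂ * y₁} (x₁ + x₂) (y₁ + y₂) y₂ x₂ (solve (x₁ ∷ y₁ ∷ x₂ ∷ y₂ ∷ [])) k≢0)
    where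
    open ≡-Reasoning
    k≡ : x₁ * y₂ - x₂ * y₁ ≡ u * (+ 2 * y₂) - x₂ * + 2 * w
    k≡ = begin
      x₁ * y₂ - x₂ * y₁                 ≡⟨ solve (x₁ ∷ y₁ ∷ x₂ ∷ y₂ ∷ []) ⟩
      (x₁ - x₂) * y₂ - x₂ * (y₁ - y₂)   ≡⟨ cong₂ (λ a b → a * y₂ - x₂ * b) x₁-x₂≡ y₁-y₂≡ ⟩
      + 2 * u * y₂ - x₂ * (+ 2 * w)     ≡⟨ solve (u ∷ w ∷ x₂ ∷ y₂ ∷ []) ⟩
      u * (+ 2 * y₂) - x₂ * + 2 * w     ∎

  form₈ : ℤ → ℤ → ℤ → Form
  form₈ e₀ f₀ h₀ = form (+ 8 * e₀) (+ 4 * f₀) (+ 8 * h₀ + + 2)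

  form₈-discriminant : ∀ e₀ f₀ h₀ →
    e (form₈ e₀ f₀ h₀) * h (form₈ e₀ f₀ h₀) - f (form₈ e₀ f₀ h₀) * f (form₈ e₀ f₀ h₀) ≡ + 16 * (+ 4 * e₀ * h₀ + e₀ - f₀ * f₀)
  form₈-discriminant = lemma
    where
    lemma : ∀ e₀ f₀ h₀ → + 8 * e₀ * (+ 8 * h₀ + + 2) - + 4 * f₀ * (+ 4 * f₀) ≡ + 16 * (+ 4 * e₀ * h₀ + e₀ - f₀ * f₀)
    lemma = solve-∀

  8n≢8m+2 : ∀ n m → + 8 * n ≢ + 8 * m + + 2
  8n≢8m+2 n m 8n≡8m+2 = even≢odd {+ 4 * n} (+ 2 * n , solve (n ∷ [])) (+ 2 * m , trans 4n≡4m+1 (solve (m ∷ [])))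
    where
    open ≡-Reasoning
    4n≡4m+1 : + 4 * n ≡ + 4 * m + + 1
    4n≡4m+1 = ℤₚ.*-cancelˡ-≡ (+ 2) _ _ (begin
      + 2 * (+ 4 * n)       ≡⟨ solve (n ∷ []) ⟩
      + 8 * n               ≡⟨ 8n≡8m+2 ⟩
      + 8 * m + + 2         ≡⟨ solve (m ∷ []) ⟩
      + 2 * (+ 4 * m + + 1) ∎)

  product-with-complement-even : ∀ n P → Even (P * (+ 2 * n + + 1 - P))
  product-with-complement-even n P with parity P
  ... | inj₁ even-P     = even* (+ 2 * n + + 1 - P) even-P
  ... | inj₂ (π , refl) = *even (+ 2 * π + + 1) {+ 2 * n + + 1 - (+ 2 * π + + 1)} (n - π , solve (n ∷ π ∷ []))

  form₈-value-even : ∀ e₀ f₀ h₀ x {y} j → y ≡ + 2 * j → Σ ℤ λ n → Q (form₈ e₀ f₀ h₀) x y ≡ + 8 * n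
  form₈-value-even e₀ f₀ h₀ x j refl =
    e₀ * x * x + f₀ * x * (+ 2 * j) + (+ 4 * h₀ + + 1) * j * j , lemma e₀ f₀ h₀ x j
    where
    lemma : ∀ e₀ f₀ h₀ x j →
      + 8 * e₀ * x * x + + 2 * (+ 4 * f₀) * x * (+ 2 * j) + (+ 8 * h₀ + + 2) * (+ 2 * j) * (+ 2 * j)
      ≡ + 8 * (e₀ * x * x + f₀ * x * (+ 2 * j) + (+ 4 * h₀ + + 1) * j * j)
    lemma = solve-∀

  form₈-value-odd : ∀ e₀ f₀ h₀ x {y} j → y ≡ + 2 * j + + 1 → Σ ℤ λ n → Q (form₈ e₀ f₀ h₀) x y ≡ + 8 * n + + 2
  form₈-value-odd e₀ f₀ h₀ x j refl =
    e₀ * x * x + f₀ * x * (+ 2 * j + + 1) + h₀ * (+ 2 * j + + 1) * (+ 2 * j + + 1) + j * j + j , lemma e₀ f₀ h₀ x j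
    where
    lemma : ∀ e₀ f₀ h₀ x j →
      + 8 * e₀ * x * x + + 2 * (+ 4 * f₀) * x * (+ 2 * j + + 1) + (+ 8 * h₀ + + 2) * (+ 2 * j + + 1) * (+ 2 * j + + 1)
      ≡ + 8 * (e₀ * x * x + f₀ * x * (+ 2 * j + + 1) + h₀ * (+ 2 * j + + 1) * (+ 2 * j + + 1) + j * j + j) + + 2
    lemma = solve-∀

  -- With m = Q(v₁) = Q(v₂) = 8n + 2 and Q(v₁ + v₂) = 8P we get B(v₁, v₂) = 4P − m, and Lagrange's
  -- identity m² − B² = 16δ·det² becomes P(4n + 1 − P) = δ·det².
  form₈-lagrange : ∀ e₀ f₀ h₀ {x₁ y₁ x₂ y₂} n P → let F = form₈ e₀ f₀ h₀ in
    Q F x₁ y₁ ≡ Q F x₂ y₂ → Q F x₁ y₁ ≡ + 8 * n + + 2 → Q F (x₁ + x₂) (y₁ + y₂) ≡ + 8 * P →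
    P * (+ 2 * (+ 2 * n) + + 1 - P) ≡ (+ 4 * e₀ * h₀ + e₀ - f₀ * f₀) * ((x₁ * y₂ - x₂ * y₁) * (x₁ * y₂ - x₂ * y₁))
  form₈-lagrange e₀ f₀ h₀ {x₁} {y₁} {x₂} {y₂} n P Q₁≡Q₂ Q₁≡ Q₁₊₂≡ = ℤₚ.*-cancelˡ-≡ (+ 16) _ _ (begin
    + 16 * (P * (+ 2 * (+ 2 * n) + + 1 - P))
      ≡⟨ lemma n P ⟩
    (+ 8 * n + + 2) * (+ 8 * n + + 2) - (+ 4 * P - (+ 8 * n + + 2)) * (+ 4 * P - (+ 8 * n + + 2))
      ≡⟨ cong₂ (λ m β → m * m - β * β) (sym Q₁≡) (sym B≡) ⟩
    Q F x₁ y₁ * Q F x₁ y₁ - B F x₁ y₁ x₂ y₂ * B F x₁ y₁ x₂ y₂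
      ≡⟨ cong (λ q → Q F x₁ y₁ * q - B F x₁ y₁ x₂ y₂ * B F x₁ y₁ x₂ y₂) Q₁≡Q₂ ⟩
    Q F x₁ y₁ * Q F x₂ y₂ - B F x₁ y₁ x₂ y₂ * B F x₁ y₁ x₂ y₂
      ≡⟨ lagrange F x₁ y₁ x₂ y₂ ⟩
    (e F * h F - f F * f F) * (k * k)
      ≡⟨ cong (_* (k * k)) (form₈-discriminant e₀ f₀ h₀) ⟩
    + 16 * δ * (k * k)
      ≡⟨ ℤₚ.*-assoc (+ 16) δ (k * k) ⟩
    + 16 * (δ * (k * k)) ∎)
    where
    open ≡-Reasoning
    F : Form
    F = form₈ e₀ f₀ h₀
    δ : ℤ
    δ = + 4 * e₀ * h₀ + e₀ - f₀ * f₀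
    k : ℤ
    k = x₁ * y₂ - x₂ * y₁
    lemma : ∀ n P → + 16 * (P * (+ 2 * (+ 2 * n) + + 1 - P))
      ≡ (+ 8 * n + + 2) * (+ 8 * n + + 2) - (+ 4 * P - (+ 8 * n + + 2)) * (+ 4 * P - (+ 8 * n + + 2))
    lemma = solve-∀
    half : ∀ m P B → + 8 * P ≡ m + m + + 2 * B → B ≡ + 4 * P - m
    half m P B 8P≡ = ℤₚ.*-cancelˡ-≡ (+ 2) B _ (begin
      + 2 * B                       ≡⟨ solve (m ∷ B ∷ []) ⟩
      m + m + + 2 * B - (m + m)     ≡⟨ cong (_- (m + m)) 8P≡ ⟨
      + 8 * P - (m + m)             ≡⟨ solve (m ∷ P ∷ []) ⟩
      + 2 * (+ 4 * P - m)           ∎)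
    B≡ : B F x₁ y₁ x₂ y₂ ≡ + 4 * P - (+ 8 * n + + 2)
    B≡ = half (+ 8 * n + + 2) P _ (begin
      + 8 * P                                                  ≡⟨ Q₁₊₂≡ ⟨
      Q F (x₁ + x₂) (y₁ + y₂)                                  ≡⟨ Q-sum F x₁ y₁ x₂ y₂ ⟩
      Q F x₁ y₁ + Q F x₂ y₂ + + 2 * B F x₁ y₁ x₂ y₂            ≡⟨ cong (λ q → Q F x₁ y₁ + q + + 2 * B F x₁ y₁ x₂ y₂) Q₁≡Q₂ ⟨
      Q F x₁ y₁ + Q F x₁ y₁ + + 2 * B F x₁ y₁ x₂ y₂            ≡⟨ cong (λ q → q + q + + 2 * B F x₁ y₁ x₂ y₂) Q₁≡ ⟩
      + 8 * n + + 2 + (+ 8 * n + + 2) + + 2 * B F x₁ y₁ x₂ y₂  ∎)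

  -- Since Q ≡ 2y² (mod 8), equal values force y₁ ≡ y₂ (mod 2).
  equal-values⇒even-det : ∀ e₀ f₀ h₀ → Odd (+ 4 * e₀ * h₀ + e₀ - f₀ * f₀) → ∀ {x₁ y₁ x₂ y₂} →
    Q (form₈ e₀ f₀ h₀) x₁ y₁ ≡ Q (form₈ e₀ f₀ h₀) x₂ y₂ → Even (x₁ * y₂ - x₂ * y₁)
  equal-values⇒even-det e₀ f₀ h₀ odd-δ {x₁} {y₁} {x₂} {y₂} Q₁≡Q₂ = cases (parity y₁) (parity y₂)
    where
    k : ℤ
    k = x₁ * y₂ - x₂ * y₁
    odd+odd : ∀ {a b j₁ j₂} → a ≡ + 2 * j₁ + + 1 → b ≡ + 2 * j₂ + + 1 → a + b ≡ + 2 * (j₁ + j₂ + + 1)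
    odd+odd {j₁ = j₁} {j₂} refl refl = solve (j₁ ∷ j₂ ∷ [])
    cases : Even y₁ ⊎ Odd y₁ → Even y₂ ⊎ Odd y₂ → Even k
    cases (inj₁ even-y₁) (inj₁ even-y₂) = even-even (*even x₁ even-y₂) (*even x₂ even-y₁)
    cases (inj₁ (j₁ , y₁≡)) (inj₂ (j₂ , y₂≡))
      with form₈-value-even e₀ f₀ h₀ x₁ j₁ y₁≡ | form₈-value-odd e₀ f₀ h₀ x₂ j₂ y₂≡
    ... | n₁ , Q₁≡ | n₂ , Q₂≡ = ⊥-elim (8n≢8m+2 n₁ n₂ (trans (sym Q₁≡) (trans Q₁≡Q₂ Q₂≡)))
    cases (inj₂ (j₁ , y₁≡)) (inj₁ (j₂ , y₂≡))
      with form₈-value-odd e₀ f₀ h₀ x₁ j₁ y₁≡ | form₈-value-even e₀ f₀ h₀ x₂ j₂ y₂≡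
    ... | n₁ , Q₁≡ | n₂ , Q₂≡ = ⊥-elim (8n≢8m+2 n₂ n₁ (trans (sym Q₂≡) (trans (sym Q₁≡Q₂) Q₁≡)))
    cases (inj₂ (j₁ , y₁≡)) (inj₂ (j₂ , y₂≡))
      with form₈-value-odd e₀ f₀ h₀ x₁ j₁ y₁≡
         | form₈-value-even e₀ f₀ h₀ (x₁ + x₂) (j₁ + j₂ + + 1) (odd+odd {j₁ = j₁} {j₂ = j₂} y₁≡ y₂≡) | parity k
    ... | _ , _     | _ , _       | inj₁ even-k = even-k
    ... | n , Q₁≡ | P , Q₁₊₂≡ | inj₂ odd-k =
      ⊥-elim (even≢odd (product-with-complement-even (+ 2 * n) P)
        (subst Odd (sym (form₈-lagrange e₀ f₀ h₀ n P Q₁≡Q₂ Q₁≡ Q₁₊₂≡)) (odd*odd odd-δ (odd*odd odd-k odd-k))))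

  form₈-not-WR : ∀ e₀ f₀ h₀ → + 0 < e₀ → + 0 < + 4 * e₀ * h₀ + e₀ - f₀ * f₀ → Odd (+ 4 * e₀ * h₀ + e₀ - f₀ * f₀) →
    ¬ WR (form₈ e₀ f₀ h₀)
  form₈-not-WR e₀ f₀ h₀ 0<e₀ 0<δ odd-δ (x₁ , y₁ , x₂ , y₂ , min₁ , min₂ , k≢0) =
    minimal-det-not-even {F} positive min₁ min₂ k≢0
      (equal-values⇒even-det e₀ f₀ h₀ odd-δ (minimal-equal {F} min₁ min₂))
    where
    F : Form
    F = form₈ e₀ f₀ h₀
    positive : PositiveDefinite F
    positive = positive-definite F (pos*pos {+ 8} (+<+ (s≤s z≤n)) 0<e₀)
                 (subst (+ 0 <_) (sym (form₈-discriminant e₀ f₀ h₀)) (pos*pos {+ 16} (+<+ (s≤s z≤n)) 0<δ))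

module IdealLattices where

  open BinaryForms
  open import Data.Integer
    using (ℤ; +_; -[1+_]; _+_; _-_; _*_; -_; ∣_∣; _<_; +<+)
  import Data.Integer.Properties as ℤₚ
  open import Data.Integer.Divisibility.Signed as ℤ∣ using (divides; ∣ᵤ⇒∣; ∣⇒∣ᵤ) renaming (_∣_ to _∣ᶻ_)
  open import Data.Integer.Tactic.RingSolver using (solve-∀)
  open import Data.Nat as ℕ using (ℕ; zero; suc; z≤n; s≤s; NonZero; _%_; _≡ᵇ_)
  import Data.Nat.Properties as ℕₚ
  import Data.Nat.Tactic.RingSolver as ℕ-Solver
  open import Data.Nat.Divisibility as ℕ∣ using (_∣_)
  open import Data.Nat.GCD using (gcd; gcd[m,n]∣m; gcd[m,n]∣n; gcd[m,n]≢0)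
  open import Data.Nat.Coprimality using (coprime-/gcd; coprime-divisor)
  open import Data.Nat.DivMod using (_/_; m/n*n≡m; m*n/n≡m; m≡m%n+[m/n]*n)
  open import Data.List using (_∷_; [])
  open import Data.Bool as Bool using (true; false; if_then_else_)
  open import Data.Unit using (tt)
  open import Data.Product using (Σ; _×_; _,_; proj₁; proj₂)
  open import Data.Sum using (_⊎_; inj₁; inj₂)
  open import Data.Empty using (⊥; ⊥-elim)
  open import Relation.Nullary using (¬_; yes; no)
  open import Relation.Binary.PropositionalEquality

  BalancedFactorisation : ℕ → Set
  BalancedFactorisation D = Σ ℕ λ d₁ → Σ ℕ λ d₂ →
    0 ℕ.< d₁ × d₁ ℕ.< d₂ × D ≡ d₁ ℕ.* d₂ × D ℕ.≤ 3 ℕ.* (d₁ ℕ.* d₁) × d₁ ℕ.* d₁ ℕ.< D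

  SimilarToΩ : ℕ → Form → Set
  SimilarToΩ D F = Σ ℕ λ p → Σ ℕ λ q →
    0 ℕ.< q × p ℕ.* p ℕ.+ D ≡ q ℕ.* q × gcd p q ≡ 1 × 2 ℕ.* p ℕ.≤ q × Similar F (omegaForm D p q)

  squarefree-not-square : ∀ {D} x → SquareFree D → 1 ℕ.< D → D ≢ x ℕ.* x
  squarefree-not-square x squarefree 1<D refl with squarefree x ℕ∣.∣-refl
  ... | refl = ℕₚ.<-irrefl refl 1<D

  squarefree-coprime : ∀ {d} p → SquareFree (d ℕ.* (d ℕ.+ 2 ℕ.* p)) → gcd p (d ℕ.+ p) ≡ 1
  squarefree-coprime {d} p squarefree =
    squarefree c (ℕ∣.*-pres-∣ c∣d (ℕ∣.∣m∣n⇒∣m+n c∣d (ℕ∣.∣-trans c∣p (ℕ∣.n∣m*n 2))))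
    where
    c : ℕ
    c = gcd p (d ℕ.+ p)
    c∣p : c ∣ p
    c∣p = gcd[m,n]∣m p (d ℕ.+ p)
    c∣d : c ∣ d
    c∣d = ℕ∣.∣m+n∣m⇒∣n (subst (c ∣_) (ℕₚ.+-comm d p) (gcd[m,n]∣n p (d ℕ.+ p))) c∣p

  +d+2p : ∀ d p → + (d ℕ.+ 2 ℕ.* p) ≡ + d + + 2 * + p
  +d+2p d p = trans (ℤₚ.pos-+ d _) (cong (λ z → + d + z) (ℤₚ.pos-* 2 p))

  omegaForm-atoms : ∀ d p → omegaForm (d ℕ.* (d ℕ.+ 2 ℕ.* p)) p (d ℕ.+ p)
    ≡ form ((+ d + + p) * (+ d + + p)) ((+ d + + p) * + p) (+ p * + p + + d * (+ d + + 2 * + p))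
  omegaForm-atoms d p =
    form-cong (cong₂ _*_ (ℤₚ.pos-+ d p) (ℤₚ.pos-+ d p)) (cong (_* + p) (ℤₚ.pos-+ d p))
              (cong (λ D → + p * + p + D) (trans (ℤₚ.pos-* d _) (cong (+ d *_) (+d+2p d p))))

  Similar-transform : ∀ {F} G a b c d → Unimodular a b c d → F ≡ transform G a b c d → Similar F G
  Similar-transform G a b c d unimodular F≡ =
    a , b , c , d , + 1 , + 1 , unimodular , +<+ (s≤s z≤n) , +<+ (s≤s z≤n) , cong (scale (+ 1)) F≡

  -- Ω_D(p, d + p) with D = d(d + 2p) has the reduced Gram matrix q·[[q , −d] , [−d , 2d]], q = d + p,
  -- in the basis (q, 0), (−d, √D); this is reduced when p ≥ d, and then e = h forces p = d.
  ω-WR⇒p≤d : ∀ d p → WR (omegaForm (d ℕ.* (d ℕ.+ 2 ℕ.* p)) p (d ℕ.+ p)) → p ℕ.≤ d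
  ω-WR⇒p≤d d p wr with p ℕ.≤? d
  ... | yes p≤d = p≤d
  ... | no p≰d  = ⊥-elim (ℕₚ.<-irrefl (sym p≡d) d<p)
    where
    d<p : d ℕ.< p
    d<p = ℕₚ.≰⇒> p≰d
    q : ℕ
    q = d ℕ.+ p
    Z : ℤ
    Z = + d + + p
    R : Form
    R = form (+ (q ℕ.* q)) (- + (q ℕ.* d)) (+ (2 ℕ.* (q ℕ.* d)))
    R≡ : R ≡ form (Z * Z) (- (Z * + d)) (+ 2 * (Z * + d))
    R≡ = form-cong (trans (ℤₚ.pos-* q q) (cong₂ _*_ (ℤₚ.pos-+ d p) (ℤₚ.pos-+ d p)))
                   (cong -_ qd≡) (trans (ℤₚ.pos-* 2 (q ℕ.* d)) (cong (+ 2 *_) qd≡))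
      where
      qd≡ : + (q ℕ.* d) ≡ Z * + d
      qd≡ = trans (ℤₚ.pos-* q d) (cong (_* + d) (ℤₚ.pos-+ d p))
    Ω≡MᵀRM : omegaForm (d ℕ.* (d ℕ.+ 2 ℕ.* p)) p q ≡ transform R (+ 1) (+ 1) (+ 0) (+ 1)
    Ω≡MᵀRM = trans (omegaForm-atoms d p)
                   (trans (form-cong (l₁ (+ d) (+ p)) (l₂ (+ d) (+ p)) (l₃ (+ d) (+ p)))
                          (cong (λ G → transform G (+ 1) (+ 1) (+ 0) (+ 1)) (sym R≡)))
      where
      l₁ : ∀ d p → (d + p) * (d + p)
        ≡ (d + p) * (d + p) * + 1 * + 1 + + 2 * - ((d + p) * d) * + 1 * + 0 + + 2 * ((d + p) * d) * + 0 * + 0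
      l₁ = solve-∀
      l₂ : ∀ d p → (d + p) * p
        ≡ (d + p) * (d + p) * + 1 * + 1 + - ((d + p) * d) * (+ 1 * + 1 + + 0 * + 1) + + 2 * ((d + p) * d) * + 0 * + 1
      l₂ = solve-∀
      l₃ : ∀ d p → p * p + d * (d + + 2 * p)
        ≡ (d + p) * (d + p) * + 1 * + 1 + + 2 * - ((d + p) * d) * + 1 * + 1 + + 2 * ((d + p) * d) * + 1 * + 1
      l₃ = solve-∀
    ∣f∣≡ : ∣ - + (q ℕ.* d) ∣ ≡ q ℕ.* d
    ∣f∣≡ = ℤₚ.∣-i∣≡∣i∣ (+ (q ℕ.* d))
    q*2d≡2qd : ∀ q d → q ℕ.* (2 ℕ.* d) ≡ 2 ℕ.* (q ℕ.* d)
    q*2d≡2qd = ℕ-Solver.solve-∀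
    2qd≤qq : 2 ℕ.* ∣ - + (q ℕ.* d) ∣ ℕ.≤ q ℕ.* q
    2qd≤qq rewrite ∣f∣≡ = subst (ℕ._≤ q ℕ.* q) (q*2d≡2qd q d)
      (ℕₚ.*-monoʳ-≤ q (ℕₚ.+-monoʳ-≤ d (ℕₚ.≤-trans (ℕₚ.≤-reflexive (ℕₚ.+-identityʳ d)) (ℕₚ.<⇒≤ d<p))))
    qq≡2qd : q ℕ.* q ≡ 2 ℕ.* (q ℕ.* d)
    qq≡2qd = reduced-WR⇒e≡h (- + (q ℕ.* d)) 2qd≤qq (ℕₚ.≤-reflexive (cong (2 ℕ.*_) ∣f∣≡))
               (WR-similar R (Similar-transform R (+ 1) (+ 1) (+ 0) (+ 1) (inj₁ refl) Ω≡MᵀRM) wr)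
    p≡d : p ≡ d
    p≡d = ℕₚ.+-cancelˡ-≡ d p d (trans q≡2d (cong (d ℕ.+_) (ℕₚ.+-identityʳ d)))
      where
      q≡2d : q ≡ 2 ℕ.* d
      q≡2d = ℕₚ.*-cancelˡ-≡ q (2 ℕ.* d) q {{ℕ.>-nonZero (ℕₚ.<-≤-trans (ℕₚ.≤-<-trans z≤n d<p) (ℕₚ.m≤n+m p d))}}
               (trans qq≡2qd (sym (q*2d≡2qd q d)))

  ω-conclusion : ∀ {D F} d p → SquareFree D → 1 ℕ.< D → D ≡ d ℕ.* (d ℕ.+ 2 ℕ.* p) →
    Similar F (omegaForm (d ℕ.* (d ℕ.+ 2 ℕ.* p)) p (d ℕ.+ p)) → WR F → BalancedFactorisation D × SimilarToΩ D F
  ω-conclusion d p squarefree 1<D refl F~Ω wr =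
    (d , d ℕ.+ 2 ℕ.* p , 0<d , d<d+2p , refl , D≤3dd , dd<D) ,
    (p , d ℕ.+ p , ℕₚ.<-≤-trans 0<d (ℕₚ.m≤m+n d p) , p²+D≡q² d p , squarefree-coprime p squarefree , 2p≤q , F~Ω)
    where
    p≤d : p ℕ.≤ d
    p≤d = ω-WR⇒p≤d d p (WR-similar (omegaForm (d ℕ.* (d ℕ.+ 2 ℕ.* p)) p (d ℕ.+ p)) F~Ω wr)
    0<d : 0 ℕ.< d
    0<d = ℕₚ.n≢0⇒n>0 (λ d≡0 → ℕₚ.n≮0 (subst (λ x → 1 ℕ.< x ℕ.* (x ℕ.+ 2 ℕ.* p)) d≡0 1<D))
    0<p : 0 ℕ.< p
    0<p = ℕₚ.n≢0⇒n>0 (λ p≡0 → squarefree-not-square d squarefree 1<D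
            (trans (cong (λ x → d ℕ.* (d ℕ.+ 2 ℕ.* x)) p≡0) (cong (d ℕ.*_) (ℕₚ.+-identityʳ d))))
    d<d+2p : d ℕ.< d ℕ.+ 2 ℕ.* p
    d<d+2p = ℕₚ.m<m+n d (ℕₚ.<-≤-trans 0<p (ℕₚ.m≤m+n p _))
    D≤3dd : d ℕ.* (d ℕ.+ 2 ℕ.* p) ℕ.≤ 3 ℕ.* (d ℕ.* d)
    D≤3dd = subst (d ℕ.* (d ℕ.+ 2 ℕ.* p) ℕ.≤_) (lemma d)
              (ℕₚ.*-monoʳ-≤ d (ℕₚ.+-monoʳ-≤ d (ℕₚ.*-monoʳ-≤ 2 p≤d)))
      where
      lemma : ∀ d → d ℕ.* (d ℕ.+ 2 ℕ.* d) ≡ 3 ℕ.* (d ℕ.* d)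
      lemma = ℕ-Solver.solve-∀
    dd<D : d ℕ.* d ℕ.< d ℕ.* (d ℕ.+ 2 ℕ.* p)
    dd<D = ℕₚ.*-monoʳ-< d {{ℕ.>-nonZero 0<d}} d<d+2p
    p²+D≡q² : ∀ d p → p ℕ.* p ℕ.+ d ℕ.* (d ℕ.+ 2 ℕ.* p) ≡ (d ℕ.+ p) ℕ.* (d ℕ.+ p)
    p²+D≡q² = ℕ-Solver.solve-∀
    2p≤q : 2 ℕ.* p ℕ.≤ d ℕ.+ p
    2p≤q = subst (ℕ._≤ d ℕ.+ p) (cong (p ℕ.+_) (sym (ℕₚ.+-identityʳ p))) (ℕₚ.+-monoˡ-≤ p p≤d)

  -- Gram matrix of the lattice spanned by (2A, 0) and (A, √(AE)).
  splitForm : ℕ → ℕ → Form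
  splitForm A E = form (+ 4 * + A * + A) (+ 2 * + A * + A) (+ A * + A + + A * + E)

  splitForm-similar-ω₁ : ∀ d p → 0 ℕ.< d →
    Similar (splitForm d (d ℕ.+ 2 ℕ.* p)) (omegaForm (d ℕ.* (d ℕ.+ 2 ℕ.* p)) p (d ℕ.+ p))
  splitForm-similar-ω₁ d p 0<d =
    + 1 , + 1 , - + 1 , + 0 , + d + + p , + 2 * + d , inj₁ refl ,
    subst (+ 0 <_) (ℤₚ.pos-+ d p) (+<+ (ℕₚ.<-≤-trans 0<d (ℕₚ.m≤m+n d p))) , pos*pos {+ 2} (+<+ (s≤s z≤n)) (+<+ 0<d) ,
    trans (cong (λ E → scale (+ d + + p) (form (+ 4 * + d * + d) (+ 2 * + d * + d) (+ d * + d + + d * E))) (+d+2p d p))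
      (trans (form-cong (l₁ (+ d) (+ p)) (l₂ (+ d) (+ p)) (l₃ (+ d) (+ p)))
             (cong (λ G → scale (+ 2 * + d) (transform G (+ 1) (+ 1) (- + 1) (+ 0))) (sym (omegaForm-atoms d p))))
    where
    l₁ : ∀ d p → (d + p) * (+ 4 * d * d)
      ≡ + 2 * d * ((d + p) * (d + p) * + 1 * + 1 + + 2 * ((d + p) * p) * + 1 * - + 1 + (p * p + d * (d + + 2 * p)) * - + 1 * - + 1)
    l₁ = solve-∀
    l₂ : ∀ d p → (d + p) * (+ 2 * d * d)
      ≡ + 2 * d * ((d + p) * (d + p) * + 1 * + 1 + ((d + p) * p) * (+ 1 * + 0 + - + 1 * + 1) + (p * p + d * (d + + 2 * p)) * - + 1 * + 0)
    l₂ = solve-∀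
    l₃ : ∀ d p → (d + p) * (d * d + d * (d + + 2 * p))
      ≡ + 2 * d * ((d + p) * (d + p) * + 1 * + 1 + + 2 * ((d + p) * p) * + 1 * + 0 + (p * p + d * (d + + 2 * p)) * + 0 * + 0)
    l₃ = solve-∀

  splitForm-similar-ω₂ : ∀ d p → 0 ℕ.< d →
    Similar (splitForm (d ℕ.+ 2 ℕ.* p) d) (omegaForm (d ℕ.* (d ℕ.+ 2 ℕ.* p)) p (d ℕ.+ p))
  splitForm-similar-ω₂ d p 0<d =
    + 1 , + 1 , + 1 , + 0 , + d + + p , + 2 * (+ d + + 2 * + p) , inj₂ refl ,
    subst (+ 0 <_) (ℤₚ.pos-+ d p) (+<+ (ℕₚ.<-≤-trans 0<d (ℕₚ.m≤m+n d p))) ,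
    pos*pos {+ 2} (+<+ (s≤s z≤n)) (subst (+ 0 <_) (+d+2p d p) (+<+ (ℕₚ.<-≤-trans 0<d (ℕₚ.m≤m+n d _)))) ,
    trans (cong (λ X → scale (+ d + + p) (form (+ 4 * X * X) (+ 2 * X * X) (X * X + X * + d))) (+d+2p d p))
      (trans (form-cong (l₁ (+ d) (+ p)) (l₂ (+ d) (+ p)) (l₃ (+ d) (+ p)))
             (cong (λ G → scale (+ 2 * (+ d + + 2 * + p)) (transform G (+ 1) (+ 1) (+ 1) (+ 0))) (sym (omegaForm-atoms d p))))
    where
    l₁ : ∀ d p → (d + p) * (+ 4 * (d + + 2 * p) * (d + + 2 * p))
      ≡ + 2 * (d + + 2 * p) * ((d + p) * (d + p) * + 1 * + 1 + + 2 * ((d + p) * p) * + 1 * + 1 + (p * p + d * (d + + 2 * p)) * + 1 * + 1)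
    l₁ = solve-∀
    l₂ : ∀ d p → (d + p) * (+ 2 * (d + + 2 * p) * (d + + 2 * p))
      ≡ + 2 * (d + + 2 * p) * ((d + p) * (d + p) * + 1 * + 1 + ((d + p) * p) * (+ 1 * + 0 + + 1 * + 1) + (p * p + d * (d + + 2 * p)) * + 1 * + 0)
    l₂ = solve-∀
    l₃ : ∀ d p → (d + p) * ((d + + 2 * p) * (d + + 2 * p) + (d + + 2 * p) * d)
      ≡ + 2 * (d + + 2 * p) * ((d + p) * (d + p) * + 1 * + 1 + + 2 * ((d + p) * p) * + 1 * + 0 + (p * p + d * (d + + 2 * p)) * + 0 * + 0)
    l₃ = solve-∀

  differ-by-even : ∀ A E → Even (+ A - + E) → (Σ ℕ λ n → A ≡ E ℕ.+ 2 ℕ.* n) ⊎ (Σ ℕ λ n → E ≡ A ℕ.+ 2 ℕ.* suc n)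
  differ-by-even A E (+ n , A-E≡) = inj₁ (n , ℤₚ.+-injective (begin
    + A                   ≡⟨ solve-A A E ⟩
    + E + (+ A - + E)     ≡⟨ cong (λ z → + E + z) A-E≡ ⟩
    + E + + 2 * + n       ≡⟨ +d+2p E n ⟨
    + (E ℕ.+ 2 ℕ.* n)     ∎))
    where
    open ≡-Reasoning
    solve-A : ∀ A E → + A ≡ + E + (+ A - + E)
    solve-A A E = lemma (+ A) (+ E)
      where
      lemma : ∀ a e → a ≡ e + (a - e)
      lemma = solve-∀
  differ-by-even A E (-[1+ n ] , A-E≡) = inj₂ (n , ℤₚ.+-injective (begin
    + E                        ≡⟨ lemma (+ A) (+ E) ⟩
    + A - (+ A - + E)          ≡⟨ cong (λ z → + A - z) A-E≡ ⟩
    + A - + 2 * -[1+ n ]       ≡⟨ lemma₂ (+ A) (+ suc n) ⟩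
    + A + + 2 * + suc n        ≡⟨ +d+2p A (suc n) ⟨
    + (A ℕ.+ 2 ℕ.* suc n)      ∎))
    where
    open ≡-Reasoning
    lemma : ∀ a e → e ≡ a - (a - e)
    lemma = solve-∀
    lemma₂ : ∀ a m → a - + 2 * (- m) ≡ a + + 2 * m
    lemma₂ = solve-∀

  factors-positive : ∀ {A E D} → A ℕ.* E ≡ D → 1 ℕ.< D → 0 ℕ.< A × 0 ℕ.< E
  factors-positive {zero}          refl ()
  factors-positive {suc A} {zero}  AE≡D 1<D = ⊥-elim (ℕₚ.n≮0 (subst (1 ℕ.<_) (trans (sym AE≡D) (ℕₚ.*-zeroʳ (suc A))) 1<D))
  factors-positive {suc A} {suc E} _    _   = s≤s z≤n , s≤s z≤n

  cofactor-too-large : ∀ {A X} k w → X ℕ.< k ℕ.* A → X ≢ (k ℕ.+ w) ℕ.* A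
  cofactor-too-large {A} k w X<kA X≡[k+w]A =
    ℕₚ.<⇒≱ X<kA (subst (k ℕ.* A ℕ.≤_) (sym X≡[k+w]A) (ℕₚ.*-monoˡ-≤ A (ℕₚ.m≤m+n k w)))

  split-conclusion : ∀ {D} A E → SquareFree D → 1 ℕ.< D → A ℕ.* E ≡ D → Even (+ A - + E) →
    WR (splitForm A E) → BalancedFactorisation D × SimilarToΩ D (splitForm A E)
  split-conclusion {D} A E squarefree 1<D AE≡D A-E-even wr with differ-by-even A E A-E-even
  ... | inj₁ (n , refl) =
    ω-conclusion E n squarefree 1<D (trans (sym AE≡D) (ℕₚ.*-comm (E ℕ.+ 2 ℕ.* n) E))
      (splitForm-similar-ω₂ E n (proj₂ (factors-positive {E ℕ.+ 2 ℕ.* n} {E} AE≡D 1<D))) wr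
  ... | inj₂ (n , refl) =
    ω-conclusion A (suc n) squarefree 1<D (sym AE≡D)
      (splitForm-similar-ω₁ A (suc n) (proj₁ (factors-positive {A} {A ℕ.+ 2 ℕ.* suc n} AE≡D 1<D))) wr

  -- With c = A / gcd(A, 2X): A ∣ 2X² forces c ∣ X and c ∣ gcd(A, 2X), so c² divides both A and X²,
  -- hence D; squarefreeness gives c = 1.
  squarefree-∣2X : ∀ {A D} X → SquareFree D → 0 ℕ.< A → A ∣ 2 ℕ.* D → + A ∣ᶻ + X * + X - + D → A ∣ 2 ℕ.* X
  squarefree-∣2X {A} {D} X squarefree 0<A A∣2D A∣X²-D =
    subst (_∣ 2 ℕ.* X) (trans (sym (ℕₚ.*-identityˡ G)) (trans (cong (ℕ._* G) (sym c≡1)) cG≡A)) (gcd[m,n]∣n A (2 ℕ.* X))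
    where
    G : ℕ
    G = gcd A (2 ℕ.* X)
    instance
      G≢0 : NonZero G
      G≢0 = ℕ.≢-nonZero (gcd[m,n]≢0 A (2 ℕ.* X) (inj₁ (ℕₚ.>⇒≢ 0<A)))
    c : ℕ
    c = A / G
    c′ : ℕ
    c′ = (2 ℕ.* X) / G
    cG≡A : c ℕ.* G ≡ A
    cG≡A = m/n*n≡m (gcd[m,n]∣m A (2 ℕ.* X))
    c′G≡2X : c′ ℕ.* G ≡ 2 ℕ.* X
    c′G≡2X = m/n*n≡m (gcd[m,n]∣n A (2 ℕ.* X))
    A∣2X² : A ∣ 2 ℕ.* (X ℕ.* X)
    A∣2X² = ∣⇒∣ᵤ (subst (+ A ∣ᶻ_) (trans (lemma (+ X) (+ D)) (sym (cast X)))
              (ℤ∣.∣m∣n⇒∣m+n (ℤ∣.∣n⇒∣m*n (+ 2) A∣X²-D) (subst (+ A ∣ᶻ_) (ℤₚ.pos-* 2 D) (∣ᵤ⇒∣ A∣2D))))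
      where
      lemma : ∀ x d → + 2 * (x * x - d) + + 2 * d ≡ + 2 * (x * x)
      lemma = solve-∀
      cast : ∀ X → + (2 ℕ.* (X ℕ.* X)) ≡ + 2 * (+ X * + X)
      cast X = trans (ℤₚ.pos-* 2 (X ℕ.* X)) (cong (+ 2 *_) (ℤₚ.pos-* X X))
    c∣X : c ∣ X
    c∣X = coprime-divisor (coprime-/gcd A (2 ℕ.* X))
            (ℕ∣.*-cancelʳ-∣ G (subst₂ _∣_ (sym cG≡A) 2X²≡c′XG A∣2X²))
      where
      open ≡-Reasoning
      2X²≡c′XG : 2 ℕ.* (X ℕ.* X) ≡ c′ ℕ.* X ℕ.* G
      2X²≡c′XG = begin
        2 ℕ.* (X ℕ.* X)    ≡⟨ ℕₚ.*-assoc 2 X X ⟨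
        2 ℕ.* X ℕ.* X      ≡⟨ cong (ℕ._* X) c′G≡2X ⟨
        c′ ℕ.* G ℕ.* X     ≡⟨ ℕₚ.*-assoc c′ G X ⟩
        c′ ℕ.* (G ℕ.* X)   ≡⟨ cong (c′ ℕ.*_) (ℕₚ.*-comm G X) ⟩
        c′ ℕ.* (X ℕ.* G)   ≡⟨ ℕₚ.*-assoc c′ X G ⟨
        c′ ℕ.* X ℕ.* G     ∎
    c∣G : c ∣ G
    c∣G = coprime-divisor (coprime-/gcd A (2 ℕ.* X)) (subst (c ∣_) (sym c′G≡2X) (ℕ∣.∣-trans c∣X (ℕ∣.n∣m*n 2)))
    c²∣D : c ℕ.* c ∣ D
    c²∣D = ∣⇒∣ᵤ (subst (+ (c ℕ.* c) ∣ᶻ_) (lemma (+ X) (+ D))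
             (ℤ∣.∣m∣n⇒∣m-n (subst (+ (c ℕ.* c) ∣ᶻ_) (ℤₚ.pos-* X X) (∣ᵤ⇒∣ (ℕ∣.*-pres-∣ c∣X c∣X)))
                           (ℤ∣.∣-trans (∣ᵤ⇒∣ (subst (c ℕ.* c ∣_) cG≡A (ℕ∣.*-pres-∣ (ℕ∣.∣-refl {c}) c∣G))) A∣X²-D)))
      where
      lemma : ∀ x d → x * x - (x * x - d) ≡ d
      lemma = solve-∀
    c≡1 : c ≡ 1
    c≡1 = squarefree c c²∣D

  if-≡1 : ∀ {A : Set} D {x y : A} → D % 4 ≡ 1 → (if D % 4 ≡ᵇ 1 then x else y) ≡ x
  if-≡1 D D%4≡1 rewrite D%4≡1 = refl

  if-≢1 : ∀ {A : Set} D {x y : A} → D % 4 ≢ 1 → (if D % 4 ≡ᵇ 1 then x else y) ≡ y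
  if-≢1 D D%4≢1 with D % 4 ≡ᵇ 1 in eq
  ... | false = refl
  ... | true  = ⊥-elim (D%4≢1 (ℕₚ.≡ᵇ⇒≡ (D % 4) 1 (subst Bool.T (sym eq) tt)))

  idealForm-scale : ∀ D A B g → idealForm D (A ℕ.* g) (B ℕ.* g) g ≡ scale (+ (g ℕ.* g)) (idealForm D A B 1)
  idealForm-scale D A B g with D % 4 ≡ᵇ 1
  ... | true  = form-cong
    (trans (cong (λ a → + 4 * a * a) (ℤₚ.pos-* A g)) (trans (l₁ (+ A) (+ g)) (cong (_* _) (sym (ℤₚ.pos-* g g)))))
    (trans (cong₂ (λ a b → + 2 * a * (+ 2 * b + + g)) (ℤₚ.pos-* A g) (ℤₚ.pos-* B g))
           (trans (l₂ (+ A) (+ B) (+ g)) (cong (_* _) (sym (ℤₚ.pos-* g g)))))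
    (trans (cong (λ b → (+ 2 * b + + g) * (+ 2 * b + + g) + + g * + g * + D) (ℤₚ.pos-* B g))
           (trans (l₃ (+ B) (+ g) (+ D)) (cong (_* _) (sym (ℤₚ.pos-* g g)))))
    where
    l₁ : ∀ a g → + 4 * (a * g) * (a * g) ≡ g * g * (+ 4 * a * a)
    l₁ = solve-∀
    l₂ : ∀ a b g → + 2 * (a * g) * (+ 2 * (b * g) + g) ≡ g * g * (+ 2 * a * (+ 2 * b + + 1))
    l₂ = solve-∀
    l₃ : ∀ b g d → (+ 2 * (b * g) + g) * (+ 2 * (b * g) + g) + g * g * d
      ≡ g * g * ((+ 2 * b + + 1) * (+ 2 * b + + 1) + + 1 * + 1 * d)
    l₃ = solve-∀
  ... | false = form-cong
    (trans (cong (λ a → + 4 * a * a) (ℤₚ.pos-* A g)) (trans (l₁ (+ A) (+ g)) (cong (_* _) (sym (ℤₚ.pos-* g g)))))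
    (trans (cong₂ (λ a b → + 4 * a * b) (ℤₚ.pos-* A g) (ℤₚ.pos-* B g))
           (trans (l₂ (+ A) (+ B) (+ g)) (cong (_* _) (sym (ℤₚ.pos-* g g)))))
    (trans (cong (λ b → + 4 * (b * b + + g * + g * + D)) (ℤₚ.pos-* B g))
           (trans (l₃ (+ B) (+ g) (+ D)) (cong (_* _) (sym (ℤₚ.pos-* g g)))))
    where
    l₁ : ∀ a g → + 4 * (a * g) * (a * g) ≡ g * g * (+ 4 * a * a)
    l₁ = solve-∀
    l₂ : ∀ a b g → + 4 * (a * g) * (b * g) ≡ g * g * (+ 4 * a * b)
    l₂ = solve-∀
    l₃ : ∀ b g d → + 4 * ((b * g) * (b * g) + g * g * d) ≡ g * g * (+ 4 * (b * b + + 1 * + 1 * d))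
    l₃ = solve-∀

  normBδ-scale : ∀ D B g → normBδ D (B ℕ.* g) g ≡ + (g ℕ.* g) * normBδ D B 1
  normBδ-scale D B g with D % 4 ≡ᵇ 1
  ... | true  = trans (cong (λ b → b * b + b * + g + + g * + g * + ((D ℕ.∸ 1) / 4) * - + 1) (ℤₚ.pos-* B g))
                      (trans (lemma (+ B) (+ g) (+ ((D ℕ.∸ 1) / 4))) (cong (_* _) (sym (ℤₚ.pos-* g g))))
    where
    lemma : ∀ b g k → (b * g) * (b * g) + (b * g) * g + g * g * k * - + 1 ≡ g * g * (b * b + b * + 1 + + 1 * + 1 * k * - + 1)
    lemma = solve-∀
  ... | false = trans (cong (λ b → b * b - + D * (+ g * + g)) (ℤₚ.pos-* B g))
                      (trans (lemma (+ B) (+ g) (+ D)) (cong (_* _) (sym (ℤₚ.pos-* g g))))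
    where
    lemma : ∀ b g d → (b * g) * (b * g) - d * (g * g) ≡ g * g * (b * b - d * (+ 1 * + 1))
    lemma = solve-∀

  idealForm≡1 idealForm≢1 : ℕ → ℕ → ℕ → ℕ → Form
  idealForm≡1 D a b g = form (+ 4 * + a * + a) (+ 2 * + a * (+ 2 * + b + + g))
                             ((+ 2 * + b + + g) * (+ 2 * + b + + g) + + g * + g * + D)
  idealForm≢1 D a b g = form (+ 4 * + a * + a) (+ 4 * + a * + b) (+ 4 * (+ b * + b + + g * + g * + D))

  idealForm≡1-square : ∀ {A} B k z α → + B * + B + + B * + 1 + + 1 * + 1 * + k * - + 1 ≡ z * + A → + A ≡ + 2 * α →
    (+ 2 * + B + + 1) * (+ 2 * + B + + 1) ≡ + 8 * (z * α) + + 4 * + k + + 1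
  idealForm≡1-square {A} B k z α N≡ A≡ = begin
    (+ 2 * + B + + 1) * (+ 2 * + B + + 1)                                   ≡⟨ lemma₁ (+ B) (+ k) ⟩
    + 4 * (+ B * + B + + B * + 1 + + 1 * + 1 * + k * - + 1) + + 4 * + k + + 1 ≡⟨ cong (λ n → + 4 * n + + 4 * + k + + 1) N≡ ⟩
    + 4 * (z * + A) + + 4 * + k + + 1                                       ≡⟨ cong (λ a → + 4 * (z * a) + + 4 * + k + + 1) A≡ ⟩
    + 4 * (z * (+ 2 * α)) + + 4 * + k + + 1                                 ≡⟨ lemma₂ z α (+ k) ⟩
    + 8 * (z * α) + + 4 * + k + + 1                                         ∎
    where
    open ≡-Reasoning
    lemma₁ : ∀ b k → (+ 2 * b + + 1) * (+ 2 * b + + 1) ≡ + 4 * (b * b + b * + 1 + + 1 * + 1 * k * - + 1) + + 4 * k + + 1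
    lemma₁ = solve-∀
    lemma₂ : ∀ z α k → + 4 * (z * (+ 2 * α)) + + 4 * k + + 1 ≡ + 8 * (z * α) + + 4 * k + + 1
    lemma₂ = solve-∀

  +1+4k : ∀ k → + (1 ℕ.+ k ℕ.* 4) ≡ + 1 + + k * + 4
  +1+4k k = trans (ℤₚ.pos-+ 1 (k ℕ.* 4)) (cong (λ n → + 1 + n) (ℤₚ.pos-* k 4))

  -- When A ≡ 2 (mod 4) the values of this form are ≡ 2y² (mod 8) and its discriminant is 16·odd.
  idealForm≡1-not-WR : ∀ {D A B} k z α → D ≡ 1 ℕ.+ k ℕ.* 4 →
    + B * + B + + B * + 1 + + 1 * + 1 * + k * - + 1 ≡ z * + A → + A ≡ + 2 * α → Odd α → ¬ WR (idealForm≡1 D A B 1)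
  idealForm≡1-not-WR {A = A} {B} k z α refl N≡ A≡ odd-α wr =
    form₈-not-WR (+ 2 * α * α) (α * C) (+ k + z * α) 0<e₀ (subst (+ 0 <_) (sym δ≡) 0<δ) (subst Odd (sym δ≡) odd-δ)
      (subst WR F≡ wr)
    where
    open ≡-Reasoning
    C : ℤ
    C = + 2 * + B + + 1
    CC≡ : C * C ≡ + 8 * (z * α) + + 4 * + k + + 1
    CC≡ = idealForm≡1-square B k z α N≡ A≡
    α≢0 : α ≢ + 0
    α≢0 refl = even≢odd (+ 0 , refl) odd-α
    0<e₀ : + 0 < + 2 * α * α
    0<e₀ = subst (+ 0 <_) (sym (ℤₚ.*-assoc (+ 2) α α)) (pos*pos {+ 2} (+<+ (s≤s z≤n)) (0<i*i α≢0))
    0<δ : + 0 < α * α * + (1 ℕ.+ k ℕ.* 4)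
    0<δ = pos*pos (0<i*i α≢0) (+<+ (s≤s z≤n))
    odd-δ : Odd (α * α * + (1 ℕ.+ k ℕ.* 4))
    odd-δ = odd*odd (odd*odd odd-α odd-α) (+ 2 * + k , trans (+1+4k k) (lemma (+ k)))
      where
      lemma : ∀ k → + 1 + k * + 4 ≡ + 2 * (+ 2 * k) + + 1
      lemma = solve-∀
    δ≡ : + 4 * (+ 2 * α * α) * (+ k + z * α) + + 2 * α * α - α * C * (α * C) ≡ α * α * + (1 ℕ.+ k ℕ.* 4)
    δ≡ = begin
      + 4 * (+ 2 * α * α) * (+ k + z * α) + + 2 * α * α - α * C * (α * C) ≡⟨ lemma₁ α (+ k) z C ⟩
      α * α * (+ 8 * (z * α) + + 8 * + k + + 2 - C * C)                  ≡⟨ cong (λ c → α * α * (+ 8 * (z * α) + + 8 * + k + + 2 - c)) CC≡ ⟩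
      α * α * (+ 8 * (z * α) + + 8 * + k + + 2 - (+ 8 * (z * α) + + 4 * + k + + 1)) ≡⟨ lemma₂ α (+ k) z ⟩
      α * α * (+ 1 + + k * + 4)                                          ≡⟨ cong (α * α *_) (+1+4k k) ⟨
      α * α * + (1 ℕ.+ k ℕ.* 4)                                          ∎
      where
      lemma₁ : ∀ α k z c → + 4 * (+ 2 * α * α) * (k + z * α) + + 2 * α * α - α * c * (α * c)
        ≡ α * α * (+ 8 * (z * α) + + 8 * k + + 2 - c * c)
      lemma₁ = solve-∀
      lemma₂ : ∀ α k z → α * α * (+ 8 * (z * α) + + 8 * k + + 2 - (+ 8 * (z * α) + + 4 * k + + 1)) ≡ α * α * (+ 1 + k * + 4)
      lemma₂ = solve-∀
    F≡ : idealForm≡1 (1 ℕ.+ k ℕ.* 4) A B 1 ≡ form₈ (+ 2 * α * α) (α * C) (+ k + z * α)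
    F≡ = form-cong
      (trans (cong (λ a → + 4 * a * a) A≡) (lemma₁ α))
      (trans (cong (λ a → + 2 * a * C) A≡) (lemma₂ α C))
      (trans (cong₂ (λ c d → c + + 1 * + 1 * d) CC≡ (+1+4k k)) (lemma₃ z α (+ k)))
      where
      lemma₁ : ∀ α → + 4 * (+ 2 * α) * (+ 2 * α) ≡ + 8 * (+ 2 * α * α)
      lemma₁ = solve-∀
      lemma₂ : ∀ α c → + 2 * (+ 2 * α) * c ≡ + 4 * (α * c)
      lemma₂ = solve-∀
      lemma₃ : ∀ z α k → + 8 * (z * α) + + 4 * k + + 1 + + 1 * + 1 * (+ 1 + k * + 4) ≡ + 8 * (k + z * α) + + 2
      lemma₃ = solve-∀

  2c≡3a⇒a≡2mod4 : ∀ {a c} → + 2 * c ≡ + 3 * a → Odd c → Σ ℤ λ α → a ≡ + 2 * α × Odd α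
  2c≡3a⇒a≡2mod4 {a} {c} 2c≡3a odd-c with parity a
  ... | inj₂ (j , refl) = ⊥-elim (even≢odd {+ 2 * c} (c , refl) (+ 3 * j + + 1 , trans 2c≡3a (lemma j)))
    where
    lemma : ∀ j → + 3 * (+ 2 * j + + 1) ≡ + 2 * (+ 3 * j + + 1) + + 1
    lemma = solve-∀
  ... | inj₁ (j , refl) with parity j
  ...   | inj₂ odd-j      = j , refl , odd-j
  ...   | inj₁ (t , refl) = ⊥-elim (even≢odd (+ 3 * t , c≡6t) odd-c)
    where
    lemma : ∀ t → + 3 * (+ 2 * (+ 2 * t)) ≡ + 2 * (+ 2 * (+ 3 * t))
    lemma = solve-∀
    c≡6t : c ≡ + 2 * (+ 3 * t)
    c≡6t = ℤₚ.*-cancelˡ-≡ (+ 2) c _ (trans 2c≡3a (lemma t))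

  +odd : ∀ B → + suc (2 ℕ.* B) ≡ + 2 * + B + + 1
  +odd B = trans (cong +_ (ℕₚ.+-comm 1 (2 ℕ.* B))) (trans (ℤₚ.pos-+ (2 ℕ.* B) 1) (cong (_+ + 1) (ℤₚ.pos-* 2 B)))

  idealForm≡1-discriminant : ∀ {D} B k → D ≡ 1 ℕ.+ k ℕ.* 4 →
    + suc (2 ℕ.* B) * + suc (2 ℕ.* B) - + D ≡ + 4 * (+ B * + B + + B * + 1 + + 1 * + 1 * + k * - + 1)
  idealForm≡1-discriminant B k refl =
    trans (cong₂ (λ c d → c * c - d) (+odd B) (+1+4k k))
          (lemma (+ B) (+ k))
    where
    lemma : ∀ b k → (+ 2 * b + + 1) * (+ 2 * b + + 1) - (+ 1 + k * + 4) ≡ + 4 * (b * b + b * + 1 + + 1 * + 1 * k * - + 1)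
    lemma = solve-∀

  split-conclusion-≡1 : ∀ {D} B k z → D ≡ 1 ℕ.+ k ℕ.* 4 → SquareFree D → 1 ℕ.< D →
    + B * + B + + B * + 1 + + 1 * + 1 * + k * - + 1 ≡ z * + suc (2 ℕ.* B) → WR (idealForm≡1 D (suc (2 ℕ.* B)) B 1) →
    BalancedFactorisation D × SimilarToΩ D (idealForm≡1 D (suc (2 ℕ.* B)) B 1)
  split-conclusion-≡1 {D} B k z D≡ squarefree 1<D N≡ wr = from-cofactor (∣⇒∣ᵤ {+ C} {+ D} (divides (+ C - + 4 * z) D≡[C-4z]C))
    where
    open ≡-Reasoning
    C : ℕ
    C = suc (2 ℕ.* B)
    D≡[C-4z]C : + D ≡ (+ C - + 4 * z) * + C
    D≡[C-4z]C = begin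
      + D                                        ≡⟨ lemma₁ (+ C) (+ D) ⟩
      + C * + C - (+ C * + C - + D)              ≡⟨ cong (λ n → + C * + C - n) (idealForm≡1-discriminant B k D≡) ⟩
      + C * + C - + 4 * (+ B * + B + + B * + 1 + + 1 * + 1 * + k * - + 1) ≡⟨ cong (λ n → + C * + C - + 4 * n) N≡ ⟩
      + C * + C - + 4 * (z * + C)                ≡⟨ lemma₂ (+ C) z ⟩
      (+ C - + 4 * z) * + C                      ∎
      where
      lemma₁ : ∀ c d → d ≡ c * c - (c * c - d)
      lemma₁ = solve-∀
      lemma₂ : ∀ c z → c * c - + 4 * (z * c) ≡ (c - + 4 * z) * c
      lemma₂ = solve-∀
    from-cofactor : C ∣ D → BalancedFactorisation D × SimilarToΩ D (idealForm≡1 D C B 1)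
    from-cofactor (ℕ∣.divides E D≡EC) =
      subst (λ F → BalancedFactorisation D × SimilarToΩ D F) (sym F≡)
        (split-conclusion C E squarefree 1<D (sym (trans D≡EC (ℕₚ.*-comm E C))) C-E-even (subst WR F≡ wr))
      where
      +D≡ : + D ≡ + E * + C
      +D≡ = trans (cong +_ D≡EC) (ℤₚ.pos-* E C)
      E≡C-4z : + E ≡ + C - + 4 * z
      E≡C-4z = ℤₚ.*-cancelʳ-≡ (+ E) (+ C - + 4 * z) (+ C) (trans (sym +D≡) D≡[C-4z]C)
      C-E-even : Even (+ C - + E)
      C-E-even = + 2 * z , trans (cong (λ e → + C - e) E≡C-4z) (lemma (+ C) z)
        where
        lemma : ∀ c z → c - (c - + 4 * z) ≡ + 2 * (+ 2 * z)
        lemma = solve-∀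
      F≡ : idealForm≡1 D C B 1 ≡ splitForm C E
      F≡ = form-cong refl (cong (+ 2 * + C *_) (sym (+odd B)))
             (trans (cong₂ (λ c d → c * c + + 1 * + 1 * d) (sym (+odd B)) +D≡) (lemma (+ C) (+ E)))
        where
        lemma : ∀ c e → c * c + + 1 * + 1 * (e * c) ≡ c * c + c * e
        lemma = solve-∀

  conclusion-≡1 : ∀ {D A B} k → D ≡ 1 ℕ.+ k ℕ.* 4 → SquareFree D → 1 ℕ.< D → B ℕ.< A →
    + A ∣ᶻ + B * + B + + B * + 1 + + 1 * + 1 * + k * - + 1 → A ∣ 2 ℕ.* D → WR (idealForm≡1 D A B 1) →
    BalancedFactorisation D × SimilarToΩ D (idealForm≡1 D A B 1)
  conclusion-≡1 {D} {A} {B} k D≡ squarefree 1<D B<A A∣N@(divides z N≡) A∣2D wr =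
    by-cofactor (squarefree-∣2X C squarefree (ℕₚ.≤-<-trans z≤n B<A) A∣2D
                   (subst (+ A ∣ᶻ_) (sym (idealForm≡1-discriminant B k D≡)) (ℤ∣.∣n⇒∣m*n (+ 4) A∣N)))
    where
    C : ℕ
    C = suc (2 ℕ.* B)
    not-WR : ∀ α → + A ≡ + 2 * α → Odd α → ⊥
    not-WR α A≡ odd-α = idealForm≡1-not-WR {A = A} {B} k z α D≡ N≡ A≡ odd-α wr
    2C<4A : 2 ℕ.* C ℕ.< 4 ℕ.* A
    2C<4A = subst (2 ℕ.* C ℕ.<_) (sym (ℕₚ.*-assoc 2 2 A))
              (ℕₚ.*-monoʳ-< 2 (subst (ℕ._≤ 2 ℕ.* A) (ℕₚ.*-suc 2 B) (ℕₚ.*-monoʳ-≤ 2 B<A)))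
    by-cofactor : A ∣ 2 ℕ.* C → BalancedFactorisation D × SimilarToΩ D (idealForm≡1 D A B 1)
    by-cofactor (ℕ∣.divides 0 ())
    by-cofactor (ℕ∣.divides 1 2C≡A) =
      ⊥-elim (not-WR (+ C) (trans (cong +_ (trans (sym (ℕₚ.+-identityʳ A)) (sym 2C≡A))) (ℤₚ.pos-* 2 C)) (+ B , +odd B))
    by-cofactor (ℕ∣.divides 2 2C≡2A) =
      subst (λ a → BalancedFactorisation D × SimilarToΩ D (idealForm≡1 D a B 1)) C≡A
        (split-conclusion-≡1 B k z D≡ squarefree 1<D (subst (λ a → _ ≡ z * + a) (sym C≡A) N≡)
                             (subst (λ a → WR (idealForm≡1 D a B 1)) (sym C≡A) wr))
      where
      C≡A : C ≡ A
      C≡A = ℕₚ.*-cancelˡ-≡ C A 2 2C≡2A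
    by-cofactor (ℕ∣.divides 3 2C≡3A) with
      2c≡3a⇒a≡2mod4 (trans (sym (ℤₚ.pos-* 2 C)) (trans (cong +_ 2C≡3A) (ℤₚ.pos-* 3 A))) (+ B , +odd B)
    ... | α , A≡ , odd-α = ⊥-elim (not-WR α A≡ odd-α)
    by-cofactor (ℕ∣.divides (suc (suc (suc (suc w)))) 2C≡[4+w]A) =
      ⊥-elim (cofactor-too-large {A} 4 w 2C<4A 2C≡[4+w]A)

  SimilarToΩ-scale : ∀ {D σ F} → + 0 < σ → SimilarToΩ D F → SimilarToΩ D (scale σ F)
  SimilarToΩ-scale {D} {σ} {F} 0<σ (p , q , 0<q , p²+D≡q² , coprime , 2p≤q , F~Ω) =
    p , q , 0<q , p²+D≡q² , coprime , 2p≤q , Similar-scaleˡ {σ} {F} {omegaForm D p q} 0<σ F~Ω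

  +4AA : ∀ A → + 4 * + A * + A ≡ + (4 ℕ.* A ℕ.* A)
  +4AA A = sym (trans (ℤₚ.pos-* (4 ℕ.* A) A) (cong (_* + A) (ℤₚ.pos-* 4 A)))

  idealForm≢1-rectangular-not-WR : ∀ {D} A → SquareFree D → 1 ℕ.< D → ¬ WR (idealForm≢1 D A 0 1)
  idealForm≢1-rectangular-not-WR {D} A squarefree 1<D wr =
    squarefree-not-square A squarefree 1<D
      (sym (ℕₚ.*-cancelˡ-≡ (A ℕ.* A) D 4
        (trans (sym (ℕₚ.*-assoc 4 A A)) (reduced-WR⇒e≡h (+ 0) z≤n z≤n (subst WR F≡ wr)))))
    where
    F≡ : idealForm≢1 D A 0 1 ≡ form (+ (4 ℕ.* A ℕ.* A)) (+ 0) (+ (4 ℕ.* D))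
    F≡ = form-cong (+4AA A) (ℤₚ.*-zeroʳ (+ 4 * + A)) (trans (lemma (+ D)) (sym (ℤₚ.pos-* 4 D)))
      where
      lemma : ∀ d → + 4 * (+ 0 * + 0 + + 1 * + 1 * d) ≡ + 4 * d
      lemma = solve-∀

  conclusion-≢1 : ∀ {D A B} → SquareFree D → 1 ℕ.< D → B ℕ.< A → + A ∣ᶻ + B * + B - + D * (+ 1 * + 1) →
    A ∣ 2 ℕ.* D → WR (idealForm≢1 D A B 1) → BalancedFactorisation D × SimilarToΩ D (idealForm≢1 D A B 1)
  conclusion-≢1 {D} {A} {B} squarefree 1<D B<A A∣N@(divides z N≡) A∣2D@(ℕ∣.divides q 2D≡qA) wr =
    by-cofactor (squarefree-∣2X B squarefree 0<A A∣2D (subst (+ A ∣ᶻ_) (lemma (+ B) (+ D)) A∣N))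
    where
    lemma : ∀ b d → b * b - d * (+ 1 * + 1) ≡ b * b - d
    lemma = solve-∀
    0<A : 0 ℕ.< A
    0<A = ℕₚ.≤-<-trans z≤n B<A
    by-cofactor : A ∣ 2 ℕ.* B → BalancedFactorisation D × SimilarToΩ D (idealForm≢1 D A B 1)
    by-cofactor (ℕ∣.divides 0 2B≡0) =
      ⊥-elim (idealForm≢1-rectangular-not-WR A squarefree 1<D (subst (λ b → WR (idealForm≢1 D A b 1)) B≡0 wr))
      where
      B≡0 : B ≡ 0
      B≡0 = ℕₚ.*-cancelˡ-≡ B 0 2 2B≡0
    by-cofactor (ℕ∣.divides (suc (suc w)) 2B≡[2+w]A) =
      ⊥-elim (cofactor-too-large {A} 2 w (ℕₚ.*-monoʳ-< 2 B<A) 2B≡[2+w]A)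
    by-cofactor (ℕ∣.divides 1 2B≡A) =
      subst (λ F → BalancedFactorisation D × SimilarToΩ D F) (sym F≡)
        (proj₁ split , SimilarToΩ-scale {σ = + 4} {F = splitForm B q} (+<+ (s≤s z≤n)) (proj₂ split))
      where
      open ≡-Reasoning
      A≡2B : A ≡ 2 ℕ.* B
      A≡2B = trans (sym (ℕₚ.+-identityʳ A)) (sym 2B≡A)
      +A≡ : + A ≡ + 2 * + B
      +A≡ = trans (cong +_ A≡2B) (ℤₚ.pos-* 2 B)
      D≡Bq : D ≡ B ℕ.* q
      D≡Bq = ℕₚ.*-cancelˡ-≡ D (B ℕ.* q) 2 (begin
        2 ℕ.* D           ≡⟨ 2D≡qA ⟩
        q ℕ.* A           ≡⟨ cong (q ℕ.*_) A≡2B ⟩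
        q ℕ.* (2 ℕ.* B)   ≡⟨ ℕ-Solver.solve (q ∷ B ∷ []) ⟩
        2 ℕ.* (B ℕ.* q)   ∎)
      +D≡ : + D ≡ + B * + q
      +D≡ = trans (cong +_ D≡Bq) (ℤₚ.pos-* B q)
      0<B : 0 ℕ.< B
      0<B = ℕₚ.n≢0⇒n>0 (λ B≡0 → ℕₚ.<⇒≢ 0<A (sym (trans A≡2B (cong (2 ℕ.*_) B≡0))))
      B-q-even : Even (+ B - + q)
      B-q-even = z , ℤₚ.*-cancelʳ-≡ (+ B - + q) (+ 2 * z) (+ B) {{ℕ.>-nonZero 0<B}} (begin
        (+ B - + q) * + B                  ≡⟨ lemma₁ (+ B) (+ q) ⟩
        + B * + B - + B * + q * (+ 1 * + 1) ≡⟨ cong (λ d → + B * + B - d * (+ 1 * + 1)) +D≡ ⟨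
        + B * + B - + D * (+ 1 * + 1)      ≡⟨ N≡ ⟩
        z * + A                            ≡⟨ cong (z *_) +A≡ ⟩
        z * (+ 2 * + B)                    ≡⟨ lemma₂ z (+ B) ⟩
        + 2 * z * + B                      ∎)
        where
        lemma₁ : ∀ b q → (b - q) * b ≡ b * b - b * q * (+ 1 * + 1)
        lemma₁ = solve-∀
        lemma₂ : ∀ z b → z * (+ 2 * b) ≡ + 2 * z * b
        lemma₂ = solve-∀
      F≡ : idealForm≢1 D A B 1 ≡ scale (+ 4) (splitForm B q)
      F≡ = form-cong (trans (cong (λ a → + 4 * a * a) +A≡) (lemma₁ (+ B)))
                     (trans (cong (λ a → + 4 * a * + B) +A≡) (lemma₂ (+ B)))
                     (trans (cong (λ d → + 4 * (+ B * + B + + 1 * + 1 * d)) +D≡) (lemma₃ (+ B) (+ q)))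
        where
        lemma₁ : ∀ b → + 4 * (+ 2 * b) * (+ 2 * b) ≡ + 4 * (+ 4 * b * b)
        lemma₁ = solve-∀
        lemma₂ : ∀ b → + 4 * (+ 2 * b) * b ≡ + 4 * (+ 2 * b * b)
        lemma₂ = solve-∀
        lemma₃ : ∀ b q → + 4 * (b * b + + 1 * + 1 * (b * q)) ≡ + 4 * (b * b + b * q)
        lemma₃ = solve-∀
      split : BalancedFactorisation D × SimilarToΩ D (splitForm B q)
      split = split-conclusion B q squarefree 1<D (sym D≡Bq) B-q-even
                (WR-scale⁻¹ {+ 4} (splitForm B q) (+<+ (s≤s z≤n)) (subst WR F≡ wr))

  %4≡1⇒≡1+4k : ∀ D → D % 4 ≡ 1 → D ≡ 1 ℕ.+ (D ℕ.∸ 1) / 4 ℕ.* 4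
  %4≡1⇒≡1+4k D D%4≡1 =
    trans D≡ (cong (λ k → 1 ℕ.+ k ℕ.* 4) (sym (trans (cong (λ n → (n ℕ.∸ 1) / 4) D≡) (m*n/n≡m (D / 4) 4))))
    where
    D≡ : D ≡ 1 ℕ.+ D / 4 ℕ.* 4
    D≡ = trans (m≡m%n+[m/n]*n D 4) (cong (ℕ._+ D / 4 ℕ.* 4) D%4≡1)

  primitive-conclusion : ∀ {D A B} → SquareFree D → 1 ℕ.< D → B ℕ.< A → + A ∣ᶻ normBδ D B 1 → A ∣ 2 ℕ.* D →
    WR (idealForm D A B 1) → BalancedFactorisation D × SimilarToΩ D (idealForm D A B 1)
  primitive-conclusion {D} {A} {B} squarefree 1<D B<A A∣N A∣2D wr with D % 4 ℕ.≟ 1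
  ... | yes D%4≡1 =
    subst (λ F → BalancedFactorisation D × SimilarToΩ D F) (sym (if-≡1 D D%4≡1))
      (conclusion-≡1 ((D ℕ.∸ 1) / 4) (%4≡1⇒≡1+4k D D%4≡1) squarefree 1<D B<A
        (subst (+ A ∣ᶻ_) (if-≡1 D D%4≡1) A∣N) A∣2D (subst WR (if-≡1 D D%4≡1) wr))
  ... | no D%4≢1 =
    subst (λ F → BalancedFactorisation D × SimilarToΩ D F) (sym (if-≢1 D D%4≢1))
      (conclusion-≢1 squarefree 1<D B<A (subst (+ A ∣ᶻ_) (if-≢1 D D%4≢1) A∣N) A∣2D (subst WR (if-≢1 D D%4≢1) wr))

  4g²≤g²+3⇒g≤1 : ∀ g → 4 ℕ.* (g ℕ.* g) ℕ.≤ g ℕ.* g ℕ.+ 3 → g ℕ.≤ 1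
  4g²≤g²+3⇒g≤1 0 _ = z≤n
  4g²≤g²+3⇒g≤1 1 _ = s≤s z≤n
  4g²≤g²+3⇒g≤1 (suc (suc h)) 4g²≤g²+3 =
    ⊥-elim (ℕₚ.m+1+n≰m (suc (suc h) ℕ.* suc (suc h) ℕ.+ 3)
      (subst (ℕ._≤ suc (suc h) ℕ.* suc (suc h) ℕ.+ 3) (lemma h) 4g²≤g²+3))
    where
    lemma : ∀ h → 4 ℕ.* (suc (suc h) ℕ.* suc (suc h))
      ≡ suc (suc h) ℕ.* suc (suc h) ℕ.+ 3 ℕ.+ suc (3 ℕ.* (h ℕ.* h) ℕ.+ 12 ℕ.* h ℕ.+ 8)
    lemma = ℕ-Solver.solve-∀

  -- Condition (1) makes the Gram matrix reduced, so its diagonal entries agree: a² = b² + g²D.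
  condition-≢1⇒AA≡BB+D : ∀ {D A B} g .{{_ : NonZero g}} → WR (idealForm≢1 D (A ℕ.* g) (B ℕ.* g) g) →
    2 ℕ.* (A ℕ.* g) ℕ.* (B ℕ.* g) ℕ.≤ (A ℕ.* g) ℕ.* (A ℕ.* g) →
    2 ℕ.* (A ℕ.* g) ℕ.* (B ℕ.* g) ℕ.≤ (B ℕ.* g) ℕ.* (B ℕ.* g) ℕ.+ D → A ℕ.* A ≡ B ℕ.* B ℕ.+ D
  condition-≢1⇒AA≡BB+D {D} {A} {B} g wr c₁ c₂ =
    ℕₚ.*-cancelˡ-≡ (A ℕ.* A) (B ℕ.* B ℕ.+ D) 4 (ℕₚ.*-cancelˡ-≡ _ _ (g ℕ.* g) {{ℕₚ.m*n≢0 g g}} (begin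
      g ℕ.* g ℕ.* (4 ℕ.* (A ℕ.* A))        ≡⟨ lemma₁ A g ⟩
      4 ℕ.* a ℕ.* a                        ≡⟨ 4aa≡4[bb+ggD] ⟩
      4 ℕ.* (b ℕ.* b ℕ.+ g ℕ.* g ℕ.* D)    ≡⟨ lemma₂ B g D ⟩
      g ℕ.* g ℕ.* (4 ℕ.* (B ℕ.* B ℕ.+ D))  ∎))
    where
    open ≡-Reasoning
    a : ℕ
    a = A ℕ.* g
    b : ℕ
    b = B ℕ.* g
    lemma₁ : ∀ A g → g ℕ.* g ℕ.* (4 ℕ.* (A ℕ.* A)) ≡ 4 ℕ.* (A ℕ.* g) ℕ.* (A ℕ.* g)
    lemma₁ = ℕ-Solver.solve-∀
    lemma₂ : ∀ B g D → 4 ℕ.* (B ℕ.* g ℕ.* (B ℕ.* g) ℕ.+ g ℕ.* g ℕ.* D) ≡ g ℕ.* g ℕ.* (4 ℕ.* (B ℕ.* B ℕ.+ D))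
    lemma₂ = ℕ-Solver.solve-∀
    F≡ : idealForm≢1 D a b g ≡ form (+ (4 ℕ.* a ℕ.* a)) (+ (4 ℕ.* a ℕ.* b)) (+ (4 ℕ.* (b ℕ.* b ℕ.+ g ℕ.* g ℕ.* D)))
    F≡ = form-cong (+4AA a) (sym (trans (ℤₚ.pos-* (4 ℕ.* a) b) (cong (_* + b) (ℤₚ.pos-* 4 a))))
           (sym (trans (ℤₚ.pos-* 4 (b ℕ.* b ℕ.+ g ℕ.* g ℕ.* D)) (cong (+ 4 *_) (trans (ℤₚ.pos-+ (b ℕ.* b) (g ℕ.* g ℕ.* D))
             (cong₂ _+_ (ℤₚ.pos-* b b) (trans (ℤₚ.pos-* (g ℕ.* g) D) (cong (_* + D) (ℤₚ.pos-* g g))))))))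
    times-4 : ∀ {n} → 2 ℕ.* a ℕ.* b ℕ.≤ n → 2 ℕ.* (4 ℕ.* a ℕ.* b) ℕ.≤ 4 ℕ.* n
    times-4 {n = n} 2ab≤n = subst (ℕ._≤ 4 ℕ.* n) (lemma a b) (ℕₚ.*-monoʳ-≤ 4 2ab≤n)
      where
      lemma : ∀ a b → 4 ℕ.* (2 ℕ.* a ℕ.* b) ≡ 2 ℕ.* (4 ℕ.* a ℕ.* b)
      lemma = ℕ-Solver.solve-∀
    4aa≡4[bb+ggD] : 4 ℕ.* a ℕ.* a ≡ 4 ℕ.* (b ℕ.* b ℕ.+ g ℕ.* g ℕ.* D)
    4aa≡4[bb+ggD] =
      reduced-WR⇒e≡h (+ (4 ℕ.* a ℕ.* b))
        (subst (2 ℕ.* (4 ℕ.* a ℕ.* b) ℕ.≤_) (sym (ℕₚ.*-assoc 4 a a)) (times-4 {n = a ℕ.* a} c₁))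
        (times-4 {n = b ℕ.* b ℕ.+ g ℕ.* g ℕ.* D}
          (ℕₚ.≤-trans c₂ (ℕₚ.+-monoʳ-≤ (b ℕ.* b) (ℕₚ.m≤n*m D (g ℕ.* g) {{ℕₚ.m*n≢0 g g}}))))
        (subst WR F≡ wr)

  -- From A ∣ 2B only A = 2B survives; then D = 3B², and condition (1) reads B²·4g² ≤ B²(g² + 3).
  condition-≢1⇒g≡1 : ∀ {D A B} g .{{_ : NonZero g}} → SquareFree D → 1 ℕ.< D → B ℕ.< A →
    A ℕ.* A ≡ B ℕ.* B ℕ.+ D → A ∣ 2 ℕ.* B →
    2 ℕ.* (A ℕ.* g) ℕ.* (B ℕ.* g) ℕ.≤ (B ℕ.* g) ℕ.* (B ℕ.* g) ℕ.+ D → g ≡ 1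
  condition-≢1⇒g≡1 {D} {A} {B} g squarefree 1<D B<A AA≡BB+D (ℕ∣.divides 0 2B≡0) _ =
    ⊥-elim (squarefree-not-square A squarefree 1<D (sym (trans AA≡BB+D (cong (λ b → b ℕ.* b ℕ.+ D) B≡0))))
    where
    B≡0 : B ≡ 0
    B≡0 = ℕₚ.*-cancelˡ-≡ B 0 2 2B≡0
  condition-≢1⇒g≡1 {D} {A} {B} g squarefree 1<D B<A _ (ℕ∣.divides (suc (suc w)) 2B≡[2+w]A) _ =
    ⊥-elim (cofactor-too-large {A} 2 w (ℕₚ.*-monoʳ-< 2 B<A) 2B≡[2+w]A)
  condition-≢1⇒g≡1 {D} {A} {B} g squarefree 1<D B<A AA≡BB+D (ℕ∣.divides 1 2B≡A) c₂ =
    ℕₚ.≤-antisym (4g²≤g²+3⇒g≤1 g (ℕₚ.*-cancelˡ-≤ (B ℕ.* B) {{ℕₚ.m*n≢0 B B {{B≢0}} {{B≢0}}}} (subst₂ ℕ._≤_ lhs rhs c₂)))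
                 (ℕ.>-nonZero⁻¹ g)
    where
    A≡2B : A ≡ 2 ℕ.* B
    A≡2B = trans (sym (ℕₚ.+-identityʳ A)) (sym 2B≡A)
    B≢0 : NonZero B
    B≢0 = ℕ.>-nonZero (ℕₚ.n≢0⇒n>0 (λ B≡0 → ℕₚ.<⇒≢ (ℕₚ.≤-<-trans z≤n B<A) (sym (trans A≡2B (cong (2 ℕ.*_) B≡0)))))
    D≡3BB : D ≡ 3 ℕ.* (B ℕ.* B)
    D≡3BB = ℕₚ.+-cancelˡ-≡ (B ℕ.* B) D (3 ℕ.* (B ℕ.* B))
              (trans (sym AA≡BB+D) (trans (cong (λ a → a ℕ.* a) A≡2B) (lemma B)))
      where
      lemma : ∀ B → 2 ℕ.* B ℕ.* (2 ℕ.* B) ≡ B ℕ.* B ℕ.+ 3 ℕ.* (B ℕ.* B)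
      lemma = ℕ-Solver.solve-∀
    lhs : 2 ℕ.* (A ℕ.* g) ℕ.* (B ℕ.* g) ≡ B ℕ.* B ℕ.* (4 ℕ.* (g ℕ.* g))
    lhs = trans (cong (λ a → 2 ℕ.* (a ℕ.* g) ℕ.* (B ℕ.* g)) A≡2B) (lemma B g)
      where
      lemma : ∀ B g → 2 ℕ.* (2 ℕ.* B ℕ.* g) ℕ.* (B ℕ.* g) ≡ B ℕ.* B ℕ.* (4 ℕ.* (g ℕ.* g))
      lemma = ℕ-Solver.solve-∀
    rhs : B ℕ.* g ℕ.* (B ℕ.* g) ℕ.+ D ≡ B ℕ.* B ℕ.* (g ℕ.* g ℕ.+ 3)
    rhs = trans (cong (B ℕ.* g ℕ.* (B ℕ.* g) ℕ.+_) D≡3BB) (lemma B g)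
      where
      lemma : ∀ B g → B ℕ.* g ℕ.* (B ℕ.* g) ℕ.+ 3 ℕ.* (B ℕ.* B) ≡ B ℕ.* B ℕ.* (g ℕ.* g ℕ.+ 3)
      lemma = ℕ-Solver.solve-∀

  conditions-≢1⇒∣2D : ∀ {D A B} g .{{_ : NonZero g}} → SquareFree D → 1 ℕ.< D → B ℕ.< A →
    + A ∣ᶻ + B * + B - + D * (+ 1 * + 1) → WR (idealForm≢1 D (A ℕ.* g) (B ℕ.* g) g) →
    2 ℕ.* (A ℕ.* g) ℕ.* (B ℕ.* g) ℕ.≤ (A ℕ.* g) ℕ.* (A ℕ.* g) →
    2 ℕ.* (A ℕ.* g) ℕ.* (B ℕ.* g) ℕ.≤ (B ℕ.* g) ℕ.* (B ℕ.* g) ℕ.+ D → A ℕ.* g ∣ 2 ℕ.* D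
  conditions-≢1⇒∣2D {D} {A} {B} g squarefree 1<D B<A A∣N wr c₁ c₂ =
    subst (λ g → A ℕ.* g ∣ 2 ℕ.* D) (sym g≡1) (subst (_∣ 2 ℕ.* D) (sym (ℕₚ.*-identityʳ A)) A∣2D)
    where
    AA≡BB+D : A ℕ.* A ≡ B ℕ.* B ℕ.+ D
    AA≡BB+D = condition-≢1⇒AA≡BB+D {D} {A} {B} g wr c₁ c₂
    A∣2D : A ∣ 2 ℕ.* D
    A∣2D = ∣⇒∣ᵤ (subst (+ A ∣ᶻ_) 2D≡ (ℤ∣.∣m∣n⇒∣m-n (divides (+ A) refl) A∣N))
      where
      +AA≡ : + A * + A ≡ + B * + B + + D
      +AA≡ = trans (sym (ℤₚ.pos-* A A)) (trans (cong +_ AA≡BB+D)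
               (trans (ℤₚ.pos-+ (B ℕ.* B) D) (cong (_+ + D) (ℤₚ.pos-* B B))))
      lemma : ∀ b d → b * b + d - (b * b - d * (+ 1 * + 1)) ≡ + 2 * d
      lemma = solve-∀
      2D≡ : + A * + A - (+ B * + B - + D * (+ 1 * + 1)) ≡ + (2 ℕ.* D)
      2D≡ = trans (cong (λ n → n - (+ B * + B - + D * (+ 1 * + 1))) +AA≡) (trans (lemma (+ B) (+ D)) (sym (ℤₚ.pos-* 2 D)))
    g≡1 : g ≡ 1
    g≡1 = condition-≢1⇒g≡1 {D} {A} {B} g squarefree 1<D B<A AA≡BB+D
            (squarefree-∣2X B squarefree (ℕₚ.≤-<-trans z≤n B<A) A∣2D (subst (+ A ∣ᶻ_) (lemma (+ B) (+ D)) A∣N)) c₂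
      where
      lemma : ∀ b d → b * b - d * (+ 1 * + 1) ≡ b * b - d
      lemma = solve-∀

  -- Condition (2) says Lg ≤ Rg, and (Lg − T) − (Rg − R) is the polynomial `slack` ≥ 0 (as A > B).
  reduced-from-condition-≡1 : ∀ A B D h → B ℕ.< A →
    8 ℕ.* (A ℕ.* suc h) ℕ.* (B ℕ.* suc h ℕ.+ 1) ℕ.≤ (2 ℕ.* (B ℕ.* suc h) ℕ.+ 1) ℕ.* (2 ℕ.* (B ℕ.* suc h) ℕ.+ 1) ℕ.+ D →
    4 ℕ.* A ℕ.* suc (2 ℕ.* B) ℕ.≤ suc (2 ℕ.* B) ℕ.* suc (2 ℕ.* B) ℕ.+ D
  reduced-from-condition-≡1 A B D h B<A Lg≤Rg with ℕₚ.m≤n⇒∃[o]m+o≡n B<A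
  ... | c , refl = ℕₚ.+-cancelˡ-≤ Rg T R (begin
    Rg ℕ.+ T            ≤⟨ ℕₚ.m≤m+n (Rg ℕ.+ T) slack ⟩
    Rg ℕ.+ T ℕ.+ slack  ≡⟨ identity B c h D ⟩
    Lg ℕ.+ R            ≤⟨ ℕₚ.+-monoˡ-≤ R Lg≤Rg ⟩
    Rg ℕ.+ R            ∎)
    where
    open ℕₚ.≤-Reasoning
    g : ℕ
    g = suc h
    C : ℕ
    C = suc (2 ℕ.* B)
    T : ℕ
    T = 4 ℕ.* (suc B ℕ.+ c) ℕ.* C
    R : ℕ
    R = C ℕ.* C ℕ.+ D
    Lg : ℕ
    Lg = 8 ℕ.* ((suc B ℕ.+ c) ℕ.* g) ℕ.* (B ℕ.* g ℕ.+ 1)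
    Rg : ℕ
    Rg = (2 ℕ.* (B ℕ.* g) ℕ.+ 1) ℕ.* (2 ℕ.* (B ℕ.* g) ℕ.+ 1) ℕ.+ D
    slack : ℕ
    slack = (h ℕ.* h ℕ.+ 2 ℕ.* h) ℕ.* (4 ℕ.* B ℕ.* B ℕ.+ 8 ℕ.* B ℕ.+ 8 ℕ.* B ℕ.* c)
            ℕ.+ 4 ℕ.* B ℕ.+ 4 ℕ.+ 4 ℕ.* c ℕ.+ 4 ℕ.* B ℕ.* h ℕ.+ 8 ℕ.* h ℕ.+ 8 ℕ.* c ℕ.* h
    identity : ∀ B c h D →
      (2 ℕ.* (B ℕ.* suc h) ℕ.+ 1) ℕ.* (2 ℕ.* (B ℕ.* suc h) ℕ.+ 1) ℕ.+ D ℕ.+ 4 ℕ.* (suc B ℕ.+ c) ℕ.* suc (2 ℕ.* B)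
      ℕ.+ ((h ℕ.* h ℕ.+ 2 ℕ.* h) ℕ.* (4 ℕ.* B ℕ.* B ℕ.+ 8 ℕ.* B ℕ.+ 8 ℕ.* B ℕ.* c)
           ℕ.+ 4 ℕ.* B ℕ.+ 4 ℕ.+ 4 ℕ.* c ℕ.+ 4 ℕ.* B ℕ.* h ℕ.+ 8 ℕ.* h ℕ.+ 8 ℕ.* c ℕ.* h)
      ≡ 8 ℕ.* ((suc B ℕ.+ c) ℕ.* suc h) ℕ.* (B ℕ.* suc h ℕ.+ 1) ℕ.+ (suc (2 ℕ.* B) ℕ.* suc (2 ℕ.* B) ℕ.+ D)
    identity = ℕ-Solver.solve-∀

  -- Condition (2) makes the Gram matrix reduced, and then e = h reads 4A² = (2B + 1)² + D ≡ 2 (mod 4).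
  conditions-≡1-impossible : ∀ {D A B} k h → D ≡ 1 ℕ.+ k ℕ.* 4 → B ℕ.< A → WR (idealForm≡1 D A B 1) →
    2 ℕ.* (A ℕ.* suc h) ℕ.* (B ℕ.* suc h ℕ.+ 1) ℕ.≤ (A ℕ.* suc h) ℕ.* (A ℕ.* suc h) →
    8 ℕ.* (A ℕ.* suc h) ℕ.* (B ℕ.* suc h ℕ.+ 1) ℕ.≤ (2 ℕ.* (B ℕ.* suc h) ℕ.+ 1) ℕ.* (2 ℕ.* (B ℕ.* suc h) ℕ.+ 1) ℕ.+ D → ⊥
  conditions-≡1-impossible {D} {A} {B} k h D≡ B<A wr c₁ c₂ =
    ℕₚ.even≢odd (A ℕ.* A) (B ℕ.* B ℕ.+ B ℕ.+ k) (ℕₚ.*-cancelˡ-≡ _ _ 2 (begin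
      2 ℕ.* (2 ℕ.* (A ℕ.* A))                 ≡⟨ lemma₁ A ⟩
      4 ℕ.* A ℕ.* A                           ≡⟨ 4AA≡CC+D ⟩
      C ℕ.* C ℕ.+ D                           ≡⟨ cong (C ℕ.* C ℕ.+_) D≡ ⟩
      C ℕ.* C ℕ.+ (1 ℕ.+ k ℕ.* 4)             ≡⟨ lemma₂ B k ⟩
      2 ℕ.* suc (2 ℕ.* (B ℕ.* B ℕ.+ B ℕ.+ k)) ∎))
    where
    open ≡-Reasoning
    g : ℕ
    g = suc h
    C : ℕ
    C = suc (2 ℕ.* B)
    lemma₁ : ∀ A → 2 ℕ.* (2 ℕ.* (A ℕ.* A)) ≡ 4 ℕ.* A ℕ.* A
    lemma₁ = ℕ-Solver.solve-∀
    lemma₂ : ∀ B k → suc (2 ℕ.* B) ℕ.* suc (2 ℕ.* B) ℕ.+ (1 ℕ.+ k ℕ.* 4) ≡ 2 ℕ.* suc (2 ℕ.* (B ℕ.* B ℕ.+ B ℕ.+ k))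
    lemma₂ = ℕ-Solver.solve-∀
    0<A : 0 ℕ.< A
    0<A = ℕₚ.≤-<-trans z≤n B<A
    C≤A : C ℕ.≤ A
    C≤A = ℕₚ.*-cancelʳ-< g (2 ℕ.* B) A (ℕₚ.<-≤-trans 2Bg<2[Bg+1] 2[Bg+1]≤Ag)
      where
      2Bg<2[Bg+1] : 2 ℕ.* B ℕ.* g ℕ.< 2 ℕ.* (B ℕ.* g ℕ.+ 1)
      2Bg<2[Bg+1] = subst₂ ℕ._<_ (sym (ℕₚ.*-assoc 2 B g)) (sym (ℕₚ.*-distribˡ-+ 2 (B ℕ.* g) 1))
                      (ℕₚ.m<m+n (2 ℕ.* (B ℕ.* g)) (s≤s z≤n))
      2[Bg+1]≤Ag : 2 ℕ.* (B ℕ.* g ℕ.+ 1) ℕ.≤ A ℕ.* g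
      2[Bg+1]≤Ag = ℕₚ.*-cancelˡ-≤ (A ℕ.* g) {{ℕₚ.m*n≢0 A g {{ℕ.>-nonZero 0<A}}}}
                     (subst (ℕ._≤ A ℕ.* g ℕ.* (A ℕ.* g)) (lemma (A ℕ.* g) (B ℕ.* g)) c₁)
        where
        lemma : ∀ a b → 2 ℕ.* a ℕ.* (b ℕ.+ 1) ≡ a ℕ.* (2 ℕ.* (b ℕ.+ 1))
        lemma = ℕ-Solver.solve-∀
    F≡ : idealForm≡1 D A B 1 ≡ form (+ (4 ℕ.* A ℕ.* A)) (+ (2 ℕ.* A ℕ.* C)) (+ (C ℕ.* C ℕ.+ D))
    F≡ = form-cong (+4AA A)
           (sym (trans (ℤₚ.pos-* (2 ℕ.* A) C) (cong₂ _*_ (ℤₚ.pos-* 2 A) (+odd B))))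
           (sym (trans (ℤₚ.pos-+ (C ℕ.* C) D)
                  (cong₂ _+_ (trans (ℤₚ.pos-* C C) (cong₂ _*_ (+odd B) (+odd B))) (lemma (+ D)))))
      where
      lemma : ∀ d → d ≡ + 1 * + 1 * d
      lemma = solve-∀
    4AA≡CC+D : 4 ℕ.* A ℕ.* A ≡ C ℕ.* C ℕ.+ D
    4AA≡CC+D = reduced-WR⇒e≡h (+ (2 ℕ.* A ℕ.* C))
      (subst (ℕ._≤ 4 ℕ.* A ℕ.* A) (lemma A C) (ℕₚ.*-monoʳ-≤ (4 ℕ.* A) C≤A))
      (subst (ℕ._≤ C ℕ.* C ℕ.+ D) (lemma A C) (reduced-from-condition-≡1 A B D h B<A c₂))
      (subst WR F≡ wr)
      where
      lemma : ∀ A C → 4 ℕ.* A ℕ.* C ≡ 2 ℕ.* (2 ℕ.* A ℕ.* C)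
      lemma = ℕ-Solver.solve-∀

open BinaryForms
open IdealLattices

open import Data.Nat using (ℕ; suc; _+_; _*_; _∸_; _/_; _<_; _≤_; _%_; s≤s; z≤n)
import Data.Nat.Properties as ℕₚ
open import Data.Nat.Divisibility using (_∣_; divides; ∣-trans; m∣m*n)
open import Data.Nat.GCD using (gcd)
open import Data.Integer using (+_; +<+) renaming (_*_ to _*ᶻ_; _<_ to _<ᶻ_)
import Data.Integer.Properties as ℤₚ
open import Data.Integer.Divisibility.Signed using (∣ᵤ⇒∣; *-cancelˡ-∣) renaming (_∣_ to _∣ᶻ_)
open import Data.Product using (Σ; _×_; _,_; proj₁; proj₂)
open import Data.Sum using (_⊎_; inj₁; inj₂)
open import Data.Empty using (⊥-elim)
open import Relation.Binary.PropositionalEquality using (_≡_; _≢_; refl; sym; trans; cong; subst; subst₂)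

lemma3p5 : (D : ℕ) → 1 < D → SquareFree D →
    (a b g : ℕ) → Canonical D a b g → WR (idealForm D a b g) →
    ((a ∣ 2 * D →
       (Σ ℕ λ d₁ → Σ ℕ λ d₂ → 0 < d₁ × d₁ < d₂ × D ≡ d₁ * d₂ ×
          D ≤ 3 * (d₁ * d₁) × d₁ * d₁ < D) ×
       (Σ ℕ λ p → Σ ℕ λ q → 0 < q × p * p + D ≡ q * q × gcd p q ≡ 1 ×
          2 * p ≤ q × Similar (idealForm D a b g) (omegaForm D p q)))
     ×
     (((D % 4 ≢ 1) × 2 * a * b ≤ a * a × 2 * a * b ≤ b * b + D)
       ⊎ ((D % 4 ≡ 1) × 2 * a * (b + 1) ≤ a * a ×
          8 * a * (b + 1) ≤ (2 * b + 1) * (2 * b + 1) + D)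
       → a ∣ 2 * D))
lemma3p5 D 1<D squarefree .(A * 0) b 0 (b<a , divides A refl , _) _ =
  ⊥-elim (ℕₚ.n≮0 (subst (b <_) (ℕₚ.*-zeroʳ A) b<a))
lemma3p5 D 1<D squarefree .(A * suc h) .(B * suc h) (suc h) (b<a , divides A refl , divides B refl , ag∣N) wr =
  conclusion , condition⇒a∣2D
  where
  g : ℕ
  g = suc h
  F≡ : idealForm D (A * g) (B * g) g ≡ scale (+ (g * g)) (idealForm D A B 1)
  F≡ = idealForm-scale D A B g
  0<g² : + 0 <ᶻ + (g * g)
  0<g² = +<+ (s≤s z≤n)
  B<A : B < A
  B<A = ℕₚ.*-cancelʳ-< g B A b<a
  wr₁ : WR (idealForm D A B 1)
  wr₁ = WR-scale⁻¹ (idealForm D A B 1) 0<g² (subst WR F≡ wr)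
  A∣N : + A ∣ᶻ normBδ D B 1
  A∣N = *-cancelˡ-∣ (+ (g * g)) (subst₂ _∣ᶻ_ agg≡ (normBδ-scale D B g) (∣ᵤ⇒∣ ag∣N))
    where
    agg≡ : + (A * g * g) ≡ + (g * g) *ᶻ + A
    agg≡ = trans (cong +_ (trans (ℕₚ.*-assoc A g g) (ℕₚ.*-comm A (g * g)))) (ℤₚ.pos-* (g * g) A)
  conclusion : A * g ∣ 2 * D → BalancedFactorisation D × SimilarToΩ D (idealForm D (A * g) (B * g) g)
  conclusion a∣2D =
    proj₁ base , subst (SimilarToΩ D) (sym F≡) (SimilarToΩ-scale {F = idealForm D A B 1} 0<g² (proj₂ base))
    where
    base : BalancedFactorisation D × SimilarToΩ D (idealForm D A B 1)
    base = primitive-conclusion squarefree 1<D B<A A∣N (∣-trans (m∣m*n g) a∣2D) wr₁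
  condition⇒a∣2D :
       ((D % 4 ≢ 1) × 2 * (A * g) * (B * g) ≤ (A * g) * (A * g) × 2 * (A * g) * (B * g) ≤ (B * g) * (B * g) + D)
       ⊎ ((D % 4 ≡ 1) × 2 * (A * g) * (B * g + 1) ≤ (A * g) * (A * g) ×
          8 * (A * g) * (B * g + 1) ≤ (2 * (B * g) + 1) * (2 * (B * g) + 1) + D) → A * g ∣ 2 * D
  condition⇒a∣2D (inj₁ (D%4≢1 , c₁ , c₂)) =
    conditions-≢1⇒∣2D g squarefree 1<D B<A (subst (+ A ∣ᶻ_) (if-≢1 D D%4≢1) A∣N)
      (subst WR (if-≢1 D D%4≢1) wr) c₁ c₂
  condition⇒a∣2D (inj₂ (D%4≡1 , c₁ , c₂)) =
    ⊥-elim (conditions-≡1-impossible ((D ∸ 1) / 4) h (%4≡1⇒≡1+4k D D%4≡1) B<A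
              (subst WR (if-≡1 D D%4≡1) wr₁) c₁ c₂)
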